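{- Let $0<p<1$, let $k\ge2$, and let $t$ be sufficiently large (in terms of $k$) with $t$ even and divisible by $k$. Then the set consisting of the vector $u_{t,p,k}$ together with all vectors in $V_{t,p,k}$ contains $t$ affinely independent vectors. In particular, for $v=(t/k,\ldots,t/k)$ we have $\mathrm{rank}(A_{t,k,v})\le\binom{t}{k}-t+1$.
   Context: Vectors are indexed by the $k$-element subsets $S$ of $[t]$. $u_{t,p,k}$ is the vector with all entries equal to $p$. For a partition $[t]=A\cup B$ with $|A|=|B|=t/2$, $v_{t,k,p}(A,B)$ is the vector with $v_{t,k,p}(A,B)_S=\frac{2p}{k}|S\cap A|$, and $V_{t,p,k}$ is the set of all such vectors over all such partitions. Vectors $w_1,\ldots,w_t$ are affinely independent if $w_1-w_2,\ldots,w_1-w_t$ are linearly independent. $A_{t,k,v}$ is the $0/1$ matrix whose columns are indexed by the $k$-subsets of $[t]$ and rows by ordered partitions $(V_1,\ldots,V_k)$ of $[t]$ with $|V_i|=v_i$, with entry $1$ iff the $k$-subset has exactly one element in each $V_i$; rank is over the reals.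
   Formalization: The parameter p ranges over the rationals, affine independence is tested with rational coefficients, and the rank of $A_{t,k,v}$ is taken over ℚ instead of over the reals. -}

module Defs where

open import Data.Nat as ℕ using (ℕ; zero; suc)
open import Data.Bool using (Bool; true; false; if_then_else_; _∧_)
open import Data.Fin using (Fin; zero; suc)
open import Data.Fin.Subset using (Subset; ∣_∣; _∩_)
open import Data.Vec using (tabulate)
open import Data.Integer using (+_)
open import Data.Rational as ℚ using (ℚ; 0ℚ; 1ℚ; _+_; _*_; _-_)
open import Data.Product using (Σ; ∃; _×_; _,_)
open import Relation.Binary.PropositionalEquality using (_≡_; _≢_)
open import Relation.Nullary.Decidable using (⌊_⌋)
import Data.Fin

-- Real-valued vectors are replaced by rational-valued ones.
-- A vector indexed by the k-subsets of [t] is a function Subset t → ℚ;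
-- only its values at subsets of cardinality k are ever inspected.
KVec : ℕ → Set
KVec t = Subset t → ℚ

-- ordinary rational division by a natural number (the k = 0 case is never used)
_/ℕ_ : ℚ → ℕ → ℚ
q /ℕ zero = 0ℚ
q /ℕ suc n = q * ((+ 1) ℚ./ suc n)

Σℚ : (m : ℕ) → (Fin m → ℚ) → ℚ
Σℚ zero f = 0ℚ
Σℚ (suc m) f = f zero + Σℚ m (λ i → f (suc i))

LinIndep : (t k m : ℕ) → (Fin m → KVec t) → Set
LinIndep t k m w =
  (c : Fin m → ℚ) →
  ((S : Subset t) → ∣ S ∣ ≡ k → Σℚ m (λ i → c i * w i S) ≡ 0ℚ) →
  (i : Fin m) → c i ≡ 0ℚ

AffIndep : (t k n : ℕ) → (Fin n → KVec t) → Set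
AffIndep t k zero w = LinIndep t k zero (λ ())
AffIndep t k (suc m) w = LinIndep t k m (λ j S → w zero S - w (suc j) S)

uVec : (t : ℕ) → ℚ → ℕ → KVec t
uVec t p k S = p

-- v_{t,k,p}(A,B) with B the complement of A: entry (2p/k)|S ∩ A|
vVec : (t k : ℕ) → ℚ → Subset t → KVec t
vVec t k p A S = ((((+ 2) ℚ./ 1) * p) /ℕ k) * ((+ ∣ S ∩ A ∣) ℚ./ 1)

-- Members of {u_{t,p,k}} ∪ V_{t,p,k}: either u, or v(A, [t]∖A) with |A| = t/2
-- (then |[t]∖A| = t/2 as well when t is even).
data Member (t : ℕ) : Set where
  uMem : Member t
  vMem : (A : Subset t) → ∣ A ∣ ≡ t ℕ./ 2 → Member t

memberVec : (t k : ℕ) → ℚ → Member t → KVec t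
memberVec t k p uMem = uVec t p k
memberVec t k p (vMem A _) = vVec t k p A

-- Ordered partitions (V₁,…,V_k) of [t] are encoded as maps f : Fin t → Fin k
-- (x ∈ V_{f x}); V_i = preimage of i.
part : {t k : ℕ} → (Fin t → Fin k) → Fin k → Subset t
part f i = tabulate (λ x → ⌊ f x Data.Fin.≟ i ⌋)

IsOrdPart : {t k : ℕ} → (v : Fin k → ℕ) → (Fin t → Fin k) → Set
IsOrdPart {k = k} v f = (i : Fin k) → ∣ part f i ∣ ≡ v i

allFin : (k : ℕ) → (Fin k → Bool) → Bool
allFin zero b = true
allFin (suc k) b = b zero ∧ allFin k (λ i → b (suc i))

Aentry : (t k : ℕ) → (Fin t → Fin k) → KVec t
Aentry t k f S = if allFin k (λ i → ∣ S ∩ part f i ∣ ℕ.≡ᵇ 1) then 1ℚ else 0ℚ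

RankAtMost : (t k : ℕ) → (Fin k → ℕ) → ℕ → Set
RankAtMost t k v r =
  (rows : Fin (suc r) → (Fin t → Fin k)) →
  ((j : Fin (suc r)) → IsOrdPart v (rows j)) →
  Σ (Fin (suc r) → ℚ) λ c →
    (Σ (Fin (suc r)) λ j → c j ≢ 0ℚ) ×
    ((S : Subset t) → ∣ S ∣ ≡ k → Σℚ (suc r) (λ j → c j * Aentry t k (rows j) S) ≡ 0ℚ)

-- ordinary natural-number division t / k (the k = 0 case is never used)
_div_ : ℕ → ℕ → ℕ
t div zero = zero
t div suc n = t ℕ./ suc n

-- On k-subsets, u = (p) and v(A, B) = ((2p/k)|S ∩ A|) are both of the form S ↦ Σ_{x∈S} e x for a
-- density e on [t] (e ≡ p/k, resp. e = (2p/k)·1_A), and for t ≥ 2k − 1 such a functional vanishes only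
-- if its density does.  With A₀ = {0, …, t/2 − 1} and the t − 2 sets obtained from A₀ by the swaps
-- 0 ↔ b (b = t/2 + 1, …, t − 1) and a ↔ t/2 (a = 1, …, t/2 − 1), the densities of the differences
-- v(A₀) − u and v(A₀) − v(A) are (p/k)(2·1_{A₀} − 1) and (2p/k)(δ_a − δ_b) along the edges of a tree,
-- and evaluating at the leaves and at 0 shows they are independent.
--
-- A row of A_{t,k,v} is the indicator of the transversals of an equipartition of [t] into k parts of
-- size m = t/k.  Counting transversals (Σ_S A(S) = m^k, Σ_S A(S)|S ∩ A| = |A| m^(k−1)) shows every row
-- is orthogonal to v(A, B) − u when |A| = t/2, hence to the t − 1 independent differences above.
-- Among C(t,k) − t + 2 rows and these t − 1 vectors in ℚ^C(t,k) there is a dependency; its part in the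
-- span of the differences is orthogonal to itself, so it vanishes, and what is left is a dependency
-- among the rows.

module Submission where

open import Defs

-- An anonymous module, so that the ℚ operators opened here do not clash with the ℕ operators in the
-- type of lemma5p1.
module _ where
  open import Algebra.Bundles using (CommutativeRing)
  open import Data.Bool using (Bool; true; false; if_then_else_; _∧_; _∨_; not; T)
  open import Data.Bool.Properties using (∧-identityʳ; ∧-zeroʳ; ∨-identityʳ)
  open import Data.Empty using (⊥-elim)
  open import Data.Fin as Fin using (Fin; zero; suc; punchIn; splitAt; join; _↑ˡ_; _↑ʳ_; toℕ; fromℕ<)
  open import Data.Fin.Properties using (toℕ-injective; toℕ-fromℕ<; toℕ<n; punchInᵢ≢i; any?)
  open import Data.Fin.Properties using (join-splitAt; splitAt-↑ˡ; splitAt-↑ʳ; splitAt⁻¹-↑ˡ; splitAt⁻¹-↑ʳ)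
  open import Data.Fin.Subset using (Subset; ∣_∣; _∩_; inside; outside; ⁅_⁆)
  open import Data.Fin.Subset.Properties using (x∈⁅x⁆; x∈⁅y⁆⇒x≡y)
  import Data.Integer as ℤ
  import Data.Integer.Properties as ℤₚ
  open import Data.List using (List; []; _∷_; _++_; length; map)
  open import Data.List.Membership.Propositional using (_∈_)
  open import Data.List.Membership.Propositional.Properties using (∈-++⁺ˡ; ∈-++⁺ʳ; ∈-map⁺)
  open import Data.List.Properties using (length-++; length-map)
  open import Data.List.Relation.Unary.Any using (here; there)
  open import Data.Nat as ℕ using (ℕ; zero; suc; s≤s; z≤n; _<ᵇ_; _≡ᵇ_)
  open import Data.Nat.Combinatorics using (_C_; nCk+nC[k+1]≡[n+1]C[k+1])
  open import Data.Nat.Coprimality using (1-coprimeTo) renaming (sym to coprime-sym)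
  open import Data.Nat.Divisibility using (_∣_; divides)
  open import Data.Nat.DivMod using (m*n/n≡m; m*[n/m]≡n)
  import Data.Nat.Properties as ℕₚ
  open import Data.Product using (Σ; _×_; _,_; proj₁; proj₂)
  open import Data.Rational as ℚ using (ℚ; 0ℚ; 1ℚ; _+_; _*_; _-_; -_; mkℚ; 1/_; _≤_; _<_)
  open import Data.Rational.Properties
  open import Data.Rational.Solver using (module +-*-Solver)
  open import Data.Sum using (_⊎_; inj₁; inj₂; [_,_]′)
  open import Data.Unit using (tt)
  open import Data.Vec using ([]; _∷_; lookup; tabulate)
  open import Data.Vec.Functional using (insertAt)
  open import Data.Vec.Functional.Properties using (insertAt-lookup; insertAt-punchIn)
  open import Data.Vec.Properties using (lookup∘tabulate; lookup-zipWith; lookup⇒[]=; []=⇒lookup)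
  open import Function using (_∘_)
  open import Relation.Binary.PropositionalEquality
  open import Relation.Nullary using (yes; no; ¬?)
  open import Relation.Nullary.Decidable using (decidable-stable; ⌊_⌋; dec-true; dec-false; isYes≗does)

  open CommutativeRing +-*-commutativeRing using (semiring)
  open import Algebra.Definitions.RawSemiring ℚ.+-*-rawSemiring using (_^_)
  open import Algebra.Properties.Semiring.Mult semiring using (×-homo-+; ×1-homo-*) renaming (_×_ to _·_)
  open import Algebra.Properties.Semiring.Sum semiring
    using (sum; sum-syntax; sum-remove; sum-cong-≗; sum-replicate-zero; ∑-distrib-+; ∑-comm; *-distribˡ-sum; *-distribʳ-sum)
  open import Algebra.Properties.CommutativeMonoid.Sum *-1-commutativeMonoid
    using () renaming (sum to prod; sum-remove to prod-remove; sum-cong-≗ to prod-cong-≗; sum-replicate to prod-replicate)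
  open import Algebra.Properties.CommutativeMonoid.Sum ℕₚ.+-0-commutativeMonoid
    using () renaming (sum to ℕsum; sum-remove to ℕsum-remove; sum-cong-≗ to ℕsum-cong-≗)
  open +-*-Solver

  ι : ℕ → ℚ
  ι n = n · 1ℚ

  ι-mkℚ : ∀ n → ι n ≡ mkℚ (ℤ.+ n) 0 (coprime-sym (1-coprimeTo n))
  ι-mkℚ zero = refl
  ι-mkℚ (suc zero) = refl
  ι-mkℚ (suc (suc n)) rewrite ι-mkℚ (suc n) =
    trans (normalize-coprime (coprime-sym (1-coprimeTo (suc (suc n ℕ.* 1)))))
          (mkℚ-cong (cong (ℤ.+_ ∘ suc) (ℕₚ.*-identityʳ (suc n))) refl)

  [+n]/1≡ι : ∀ n → (ℤ.+ n) ℚ./ 1 ≡ ι n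
  [+n]/1≡ι n = trans (normalize-coprime _) (sym (ι-mkℚ n))

  ι-injective : ∀ {m n} → ι m ≡ ι n → m ≡ n
  ι-injective {m} {n} e = ℤₚ.+-injective (cong ℚ.numerator (trans (sym (ι-mkℚ m)) (trans e (ι-mkℚ n))))

  ι[1+n]≢0 : ∀ n → ι (suc n) ≢ 0ℚ
  ι[1+n]≢0 n e with ι-injective {suc n} {0} e
  ... | ()

  [1/n]*ι[n]≡1 : ∀ n → (ℤ.+ 1) ℚ./ suc n * ι (suc n) ≡ 1ℚ
  [1/n]*ι[n]≡1 n rewrite ι-mkℚ (suc n) | normalize-coprime {1} {n} (1-coprimeTo (suc n)) =
    *-inverseˡ (mkℚ (ℤ.+ suc n) 0 (coprime-sym (1-coprimeTo (suc n))))

  p≢0⇒p*q≡0⇒q≡0 : ∀ {p q} → p ≢ 0ℚ → p * q ≡ 0ℚ → q ≡ 0ℚ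
  p≢0⇒p*q≡0⇒q≡0 {p} {q} p≢0 pq≡0 = begin
      q                ≡⟨ sym (*-identityˡ q) ⟩
      1ℚ * q           ≡⟨ cong (_* q) (sym (*-inverseˡ p)) ⟩
      1/ p * p * q     ≡⟨ *-assoc (1/ p) p q ⟩
      1/ p * (p * q)   ≡⟨ cong (1/ p *_) pq≡0 ⟩
      1/ p * 0ℚ        ≡⟨ *-zeroʳ (1/ p) ⟩
      0ℚ               ∎
    where open ≡-Reasoning
          instance _ = ℚ.≢-nonZero p≢0

  p*q≡0⇒p≡0⊎q≡0 : ∀ {p q} → p * q ≡ 0ℚ → p ≡ 0ℚ ⊎ q ≡ 0ℚ
  p*q≡0⇒p≡0⊎q≡0 {p} pq≡0 with p ≟ 0ℚ
  ... | yes p≡0 = inj₁ p≡0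
  ... | no p≢0 = inj₂ (p≢0⇒p*q≡0⇒q≡0 p≢0 pq≡0)

  *-distribˡ-minus : ∀ a b c → a * (b - c) ≡ a * b - a * c
  *-distribˡ-minus = solve 3 (λ a b c → a :* (b :- c) := a :* b :- a :* c) refl

  square-nonNeg : ∀ p → 0ℚ ≤ p * p
  square-nonNeg p with ≤-total 0ℚ p
  ... | inj₁ 0≤p = nonNegative⁻¹ (p * p) {{nonNeg*nonNeg⇒nonNeg p {{ℚ.nonNegative 0≤p}} p {{ℚ.nonNegative 0≤p}}}}
  ... | inj₂ p≤0 = nonNegative⁻¹ (p * p) {{nonPos*nonPos⇒nonPos p {{ℚ.nonPositive p≤0}} p {{ℚ.nonPositive p≤0}}}}

  nonNeg+nonNeg≡0 : ∀ {p q} → 0ℚ ≤ p → 0ℚ ≤ q → p + q ≡ 0ℚ → p ≡ 0ℚ × q ≡ 0ℚ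
  nonNeg+nonNeg≡0 {p} {q} 0≤p 0≤q p+q≡0 = ≤-antisym p≤0 0≤p , ≤-antisym q≤0 0≤q
    where
      p≤0 : p ≤ 0ℚ
      p≤0 = subst (p ≤_) p+q≡0 (subst (_≤ p + q) (+-identityʳ p) (+-monoʳ-≤ p 0≤q))
      q≤0 : q ≤ 0ℚ
      q≤0 = subst (q ≤_) p+q≡0 (subst (_≤ p + q) (+-identityˡ q) (+-monoˡ-≤ q 0≤p))

  𝟙 : Bool → ℚ
  𝟙 b = if b then 1ℚ else 0ℚ

  𝟙-∧ : ∀ a b → 𝟙 (a ∧ b) ≡ 𝟙 a * 𝟙 b
  𝟙-∧ true b = sym (*-identityˡ (𝟙 b))
  𝟙-∧ false b = sym (*-zeroˡ (𝟙 b))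

  ≡ᵇ-refl : ∀ n → (n ≡ᵇ n) ≡ true
  ≡ᵇ-refl n = dec-true (n ℕ.≟ n) refl

  ≢⇒≡ᵇ≡false : ∀ {m n} → m ≢ n → (m ≡ᵇ n) ≡ false
  ≢⇒≡ᵇ≡false {m} {n} m≢n = dec-false (m ℕ.≟ n) m≢n

  <⇒<ᵇ≡true : ∀ {m n} → m ℕ.< n → (m <ᵇ n) ≡ true
  <⇒<ᵇ≡true {zero} {suc n} _ = refl
  <⇒<ᵇ≡true {suc m} {suc n} (s≤s m<n) = <⇒<ᵇ≡true m<n

  ≥⇒<ᵇ≡false : ∀ {m n} → n ℕ.≤ m → (m <ᵇ n) ≡ false
  ≥⇒<ᵇ≡false {m} {zero} _ = refl
  ≥⇒<ᵇ≡false {suc m} {suc n} (s≤s n≤m) = ≥⇒<ᵇ≡false n≤m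

  ⌊≟⌋-refl : ∀ {k} (j : Fin k) → ⌊ j Fin.≟ j ⌋ ≡ true
  ⌊≟⌋-refl j = trans (isYes≗does (j Fin.≟ j)) (dec-true (j Fin.≟ j) refl)

  ⌊≟⌋-≢ : ∀ {k} {i j : Fin k} → i ≢ j → ⌊ i Fin.≟ j ⌋ ≡ false
  ⌊≟⌋-≢ {i = i} {j} i≢j = trans (isYes≗does (i Fin.≟ j)) (dec-false (i Fin.≟ j) i≢j)

  Σℚ≡sum : ∀ m (f : Fin m → ℚ) → Σℚ m f ≡ sum f
  Σℚ≡sum zero f = refl
  Σℚ≡sum (suc m) f = cong (λ s → f zero + s) (Σℚ≡sum m (f ∘ suc))

  ∑-distrib-- : ∀ {n} (f g : Fin n → ℚ) → ∑[ i < n ] (f i - g i) ≡ ∑[ i < n ] f i - ∑[ i < n ] g i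
  ∑-distrib-- {zero} f g = refl
  ∑-distrib-- {suc n} f g rewrite ∑-distrib-- (f ∘ suc) (g ∘ suc) =
    solve 4 (λ a b c d → (a :- b) :+ (c :- d) := (a :+ c) :- (b :+ d)) refl (f zero) (g zero) _ _

  sum-zeros : ∀ {n} {f : Fin n → ℚ} → (∀ i → f i ≡ 0ℚ) → sum f ≡ 0ℚ
  sum-zeros {n} f≡0 = trans (sum-cong-≗ f≡0) (sum-replicate-zero n)

  sum-const : ∀ n x → ∑[ i < n ] x ≡ ι n * x
  sum-const zero x = sym (*-zeroˡ x)
  sum-const (suc n) x = trans (cong (x +_) (sum-const n x)) (solve 2 (λ x m → x :+ m :* x := (con 1ℚ :+ m) :* x) refl x (ι n))

  sum-single : ∀ {n} (f : Fin n → ℚ) j → (∀ i → i ≢ j → f i ≡ 0ℚ) → sum f ≡ f j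
  sum-single {suc n} f j f≡0 = begin
      sum f                       ≡⟨ sum-remove {i = j} f ⟩
      f j + sum (f ∘ punchIn j)   ≡⟨ cong (λ s → f j + s) (sum-zeros (λ i → f≡0 (punchIn j i) (punchInᵢ≢i j i))) ⟩
      f j + 0ℚ                    ≡⟨ +-identityʳ (f j) ⟩
      f j                         ∎
    where open ≡-Reasoning

  sum-↑ : ∀ m {n} (f : Fin (m ℕ.+ n) → ℚ) → sum f ≡ sum (λ i → f (i ↑ˡ n)) + sum (λ j → f (m ↑ʳ j))
  sum-↑ zero f = sym (+-identityˡ (sum f))
  sum-↑ (suc m) f = trans (cong (λ s → f zero + s) (sum-↑ m (f ∘ suc))) (sym (+-assoc (f zero) _ _))

  sum-at : ∀ {t} (x : Fin t) (E : Fin t → ℚ) → ∑[ y < t ] (𝟙 (toℕ y ≡ᵇ toℕ x) * E y) ≡ E x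
  sum-at {t} x E = begin
      ∑[ y < t ] (𝟙 (toℕ y ≡ᵇ toℕ x) * E y)
        ≡⟨ sum-single (λ y → 𝟙 (toℕ y ≡ᵇ toℕ x) * E y) x
             (λ y y≢x → trans (cong (λ b → 𝟙 b * E y) (≢⇒≡ᵇ≡false (y≢x ∘ toℕ-injective))) (*-zeroˡ (E y))) ⟩
      𝟙 (toℕ x ≡ᵇ toℕ x) * E x
        ≡⟨ cong (λ b → 𝟙 b * E x) (≡ᵇ-refl (toℕ x)) ⟩
      1ℚ * E x
        ≡⟨ *-identityˡ (E x) ⟩
      E x ∎
    where open ≡-Reasoning

  sum-≡ᵇ : ∀ {t} a → a ℕ.< t → ∑[ y < t ] 𝟙 (toℕ y ≡ᵇ a) ≡ 1ℚ
  sum-≡ᵇ {t} a a<t = begin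
      ∑[ y < t ] 𝟙 (toℕ y ≡ᵇ a)
        ≡⟨ sum-cong-≗ {t} (λ y → sym (*-identityʳ (𝟙 (toℕ y ≡ᵇ a)))) ⟩
      ∑[ y < t ] (𝟙 (toℕ y ≡ᵇ a) * 1ℚ)
        ≡⟨ cong (λ n → ∑[ y < t ] (𝟙 (toℕ y ≡ᵇ n) * 1ℚ)) (sym (toℕ-fromℕ< a<t)) ⟩
      ∑[ y < t ] (𝟙 (toℕ y ≡ᵇ toℕ (fromℕ< a<t)) * 1ℚ)
        ≡⟨ sum-at (fromℕ< a<t) (λ _ → 1ℚ) ⟩
      1ℚ ∎
    where open ≡-Reasoning

  sum-<ᵇ : ∀ {t} l → l ℕ.≤ t → ∑[ y < t ] 𝟙 (toℕ y <ᵇ l) ≡ ι l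
  sum-<ᵇ {t} zero _ = sum-zeros {t} {λ y → 𝟙 (toℕ y <ᵇ 0)} (λ _ → refl)
  sum-<ᵇ {suc t} (suc l) (s≤s l≤t) = cong (1ℚ +_) (sum-<ᵇ l l≤t)

  ι-size : ∀ {t} (S : Subset t) → ι ∣ S ∣ ≡ ∑[ x < t ] 𝟙 (lookup S x)
  ι-size [] = refl
  ι-size (true ∷ S) = cong (1ℚ +_) (ι-size S)
  ι-size (false ∷ S) = trans (ι-size S) (sym (+-identityˡ _))

  ι-size-∩ : ∀ {t} (S A : Subset t) → ι ∣ S ∩ A ∣ ≡ ∑[ x < t ] (𝟙 (lookup S x) * 𝟙 (lookup A x))
  ι-size-∩ S A = trans (ι-size (S ∩ A))
    (sum-cong-≗ (λ x → trans (cong 𝟙 (lookup-zipWith _∧_ x S A)) (𝟙-∧ (lookup S x) (lookup A x))))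

  ι-size-tabulate : ∀ t (P : ℕ → Bool) → ι ∣ tabulate {n = t} (P ∘ toℕ) ∣ ≡ ∑[ y < t ] 𝟙 (P (toℕ y))
  ι-size-tabulate t P = trans (ι-size (tabulate {n = t} (P ∘ toℕ)))
    (sum-cong-≗ {t} (λ y → cong 𝟙 (lookup∘tabulate (P ∘ toℕ) y)))

  -- Linear algebra over ℚ, with coordinates drawn from a list

  module _ {X : Set} where

    listSum : List X → (X → ℚ) → ℚ
    listSum [] g = 0ℚ
    listSum (x ∷ xs) g = g x + listSum xs g

    infix 5 listSum
    syntax listSum xs (λ x → e) = ∑[ x ∈ xs ] e

    listSum-cong : ∀ xs {g h : X → ℚ} → (∀ {x} → x ∈ xs → g x ≡ h x) → listSum xs g ≡ listSum xs h
    listSum-cong [] g≡h = refl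
    listSum-cong (x ∷ xs) g≡h = cong₂ _+_ (g≡h (here refl)) (listSum-cong xs (g≡h ∘ there))

    listSum-cong-≗ : ∀ xs {g h : X → ℚ} → (∀ x → g x ≡ h x) → listSum xs g ≡ listSum xs h
    listSum-cong-≗ xs g≡h = listSum-cong xs (λ {x} _ → g≡h x)

    *-distribˡ-listSum : ∀ xs c (g : X → ℚ) → c * listSum xs g ≡ ∑[ x ∈ xs ] c * g x
    *-distribˡ-listSum [] c g = *-zeroʳ c
    *-distribˡ-listSum (x ∷ xs) c g =
      trans (*-distribˡ-+ c (g x) _) (cong (λ s → c * g x + s) (*-distribˡ-listSum xs c g))

    listSum-distrib-- : ∀ xs (g h : X → ℚ) → ∑[ x ∈ xs ] (g x - h x) ≡ listSum xs g - listSum xs h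
    listSum-distrib-- [] g h = refl
    listSum-distrib-- (x ∷ xs) g h rewrite listSum-distrib-- xs g h =
      solve 4 (λ a b c d → (a :- b) :+ (c :- d) := (a :+ c) :- (b :+ d)) refl (g x) (h x) (listSum xs g) (listSum xs h)

    listSum-sum : ∀ xs {m} (f : Fin m → X → ℚ) → ∑[ x ∈ xs ] sum (λ i → f i x) ≡ ∑[ i < m ] listSum xs (f i)
    listSum-sum [] {m} f = sym (sum-replicate-zero m)
    listSum-sum (x ∷ xs) f =
      trans (cong (λ s → sum (λ i → f i x) + s) (listSum-sum xs f)) (sym (∑-distrib-+ (λ i → f i x) _))

    VanishesOn : List X → (X → ℚ) → Set
    VanishesOn xs g = ∀ {x} → x ∈ xs → g x ≡ 0ℚ

    vanishes⇒listSum≡0 : ∀ xs {g} → VanishesOn xs g → listSum xs g ≡ 0ℚ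
    vanishes⇒listSum≡0 [] g≡0 = refl
    vanishes⇒listSum≡0 (x ∷ xs) g≡0 =
      trans (cong₂ _+_ (g≡0 (here refl)) (vanishes⇒listSum≡0 xs (g≡0 ∘ there))) (+-identityʳ 0ℚ)

    listSum-squares-nonNeg : ∀ xs (g : X → ℚ) → 0ℚ ≤ ∑[ x ∈ xs ] g x * g x
    listSum-squares-nonNeg [] g = ≤-refl
    listSum-squares-nonNeg (x ∷ xs) g =
      subst (λ z → z ≤ g x * g x + listSum xs (λ y → g y * g y)) (+-identityʳ 0ℚ)
            (+-mono-≤ (square-nonNeg (g x)) (listSum-squares-nonNeg xs g))

    listSum-squares≡0⇒vanishes : ∀ xs (g : X → ℚ) → ∑[ x ∈ xs ] g x * g x ≡ 0ℚ → VanishesOn xs g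
    listSum-squares≡0⇒vanishes (x ∷ xs) g sq≡0 (here refl)
      with p*q≡0⇒p≡0⊎q≡0 (proj₁ (nonNeg+nonNeg≡0 (square-nonNeg (g x)) (listSum-squares-nonNeg xs g) sq≡0))
    ... | inj₁ gx≡0 = gx≡0
    ... | inj₂ gx≡0 = gx≡0
    listSum-squares≡0⇒vanishes (x ∷ xs) g sq≡0 (there x∈xs) = listSum-squares≡0⇒vanishes xs g
      (proj₂ (nonNeg+nonNeg≡0 (square-nonNeg (g x)) (listSum-squares-nonNeg xs g) sq≡0)) x∈xs

    linComb : ∀ {m} → (Fin m → ℚ) → (Fin m → X → ℚ) → X → ℚ
    linComb {m} c v x = ∑[ i < m ] (c i * v i x)

    Dependent : List X → ∀ m → (Fin m → X → ℚ) → Set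
    Dependent xs m ys = Σ (Fin m → ℚ) λ c → (Σ (Fin m) λ i → c i ≢ 0ℚ) × VanishesOn xs (linComb c ys)

    Independent : List X → ∀ m → (Fin m → X → ℚ) → Set
    Independent xs m zs = ∀ c → VanishesOn xs (linComb c zs) → ∀ i → c i ≡ 0ℚ

    linComb-zeros : ∀ {m} (c : Fin m → ℚ) (v : Fin m → X → ℚ) x → (∀ i → v i x ≡ 0ℚ) → linComb c v x ≡ 0ℚ
    linComb-zeros c v x v≡0 = sum-zeros (λ i → trans (cong (c i *_) (v≡0 i)) (*-zeroʳ (c i)))

    dependent-∷-zero-column : ∀ {c cs m} (ys : Fin m → X → ℚ) → (∀ i → ys i c ≡ 0ℚ) →
      Dependent cs m ys → Dependent (c ∷ cs) m ys
    dependent-∷-zero-column {c} ys column≡0 (e , e≢0 , vanish) = e , e≢0 , λ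
      { (here refl) → linComb-zeros e ys c column≡0
      ; (there x∈cs) → vanish x∈cs }

    module Pivot {m} (ys : Fin (suc m) → X → ℚ) (j : Fin (suc m)) (c : X) (pivot≢0 : ys j c ≢ 0ℚ) where

      ratio : Fin m → ℚ
      ratio i = ys (punchIn j i) c * 1/ (ys j c)
        where instance _ = ℚ.≢-nonZero pivot≢0

      cleared : Fin m → X → ℚ
      cleared i x = ys (punchIn j i) x - ratio i * ys j x

      cleared-column≡0 : ∀ i → cleared i c ≡ 0ℚ
      cleared-column≡0 i = begin
          y - y * 1/ p * p     ≡⟨ cong (λ z → y - z) (*-assoc y (1/ p) p) ⟩
          y - y * (1/ p * p)   ≡⟨ cong (λ z → y - y * z) (*-inverseˡ p) ⟩
          y - y * 1ℚ           ≡⟨ solve 1 (λ y → y :- y :* con 1ℚ := con 0ℚ) refl y ⟩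
          0ℚ                   ∎
        where
          open ≡-Reasoning
          p = ys j c
          y = ys (punchIn j i) c
          instance _ = ℚ.≢-nonZero pivot≢0

      lift : (Fin m → ℚ) → Fin (suc m) → ℚ
      lift e = insertAt e j (- ∑[ i < m ] (e i * ratio i))

      linComb-lift : ∀ e x → linComb (lift e) ys x ≡ linComb e cleared x
      linComb-lift e x = begin
          linComb (lift e) ys x
            ≡⟨ sum-remove {i = j} (λ k → lift e k * ys k x) ⟩
          lift e j * ys j x + ∑[ i < m ] (lift e (punchIn j i) * ys (punchIn j i) x)
            ≡⟨ cong₂ (λ a b → a * ys j x + b) (insertAt-lookup e j _)
                 (sum-cong-≗ (λ i → cong (_* ys (punchIn j i) x) (insertAt-punchIn e j _ i))) ⟩
          (- ∑[ i < m ] (e i * ratio i)) * ys j x + ∑[ i < m ] (e i * ys (punchIn j i) x)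
            ≡⟨ cong (λ s → s + ∑[ i < m ] (e i * ys (punchIn j i) x))
                 (trans (sym (neg-distribˡ-* (∑[ i < m ] (e i * ratio i)) (ys j x)))
                        (cong -_ (*-distribʳ-sum {m} (ys j x) (λ i → e i * ratio i)))) ⟩
          - ∑[ i < m ] (e i * ratio i * ys j x) + ∑[ i < m ] (e i * ys (punchIn j i) x)
            ≡⟨ solve 2 (λ a b → :- a :+ b := b :- a) refl
                 (∑[ i < m ] (e i * ratio i * ys j x)) (∑[ i < m ] (e i * ys (punchIn j i) x)) ⟩
          ∑[ i < m ] (e i * ys (punchIn j i) x) - ∑[ i < m ] (e i * ratio i * ys j x)
            ≡⟨ sym (∑-distrib-- (λ i → e i * ys (punchIn j i) x) (λ i → e i * ratio i * ys j x)) ⟩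
          ∑[ i < m ] (e i * ys (punchIn j i) x - e i * ratio i * ys j x)
            ≡⟨ sum-cong-≗ (λ i → solve 4 (λ e y r p → e :* y :- e :* r :* p := e :* (y :- r :* p)) refl
                 (e i) (ys (punchIn j i) x) (ratio i) (ys j x)) ⟩
          linComb e cleared x ∎
        where open ≡-Reasoning

      dependent-∷ : ∀ {cs} → Dependent cs m cleared → Dependent (c ∷ cs) (suc m) ys
      dependent-∷ (e , (i , eᵢ≢0) , vanish) = lift e , (punchIn j i , eᵢ≢0 ∘ trans (sym (insertAt-punchIn e j _ i))) , λ
        { (here refl) → trans (linComb-lift e c) (linComb-zeros e cleared c cleared-column≡0)
        ; (there x∈cs) → trans (linComb-lift e _) (vanish x∈cs) }

    more-vectors-than-coordinates⇒dependent : ∀ xs {m} (ys : Fin m → X → ℚ) → length xs ℕ.< m → Dependent xs m ys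
    more-vectors-than-coordinates⇒dependent [] {suc m} ys _ = (λ _ → 1ℚ) , (zero , 1≢0) , λ ()
    more-vectors-than-coordinates⇒dependent (c ∷ cs) {suc m} ys (s≤s |cs|<m)
      with any? (λ j → ¬? (ys j c ≟ 0ℚ))
    ... | yes (j , pivot≢0) = Pivot.dependent-∷ ys j c pivot≢0
      (more-vectors-than-coordinates⇒dependent cs (Pivot.cleared ys j c pivot≢0) |cs|<m)
    ... | no no-pivot = dependent-∷-zero-column ys (λ j → decidable-stable (ys j c ≟ 0ℚ) (λ ys≢0 → no-pivot (j , ys≢0)))
      (more-vectors-than-coordinates⇒dependent cs ys (ℕₚ.m<n⇒m<1+n |cs|<m))

    listSum-linComb-* : ∀ xs {m} (a : Fin m → ℚ) (ys : Fin m → X → ℚ) (g : X → ℚ) →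
      ∑[ x ∈ xs ] linComb a ys x * g x ≡ ∑[ i < m ] (a i * (∑[ x ∈ xs ] ys i x * g x))
    listSum-linComb-* xs {m} a ys g = begin
        ∑[ x ∈ xs ] linComb a ys x * g x
          ≡⟨ listSum-cong-≗ xs (λ x → trans (*-distribʳ-sum (g x) (λ i → a i * ys i x))
                                              (sum-cong-≗ (λ i → *-assoc (a i) (ys i x) (g x)))) ⟩
        ∑[ x ∈ xs ] ∑[ i < m ] (a i * (ys i x * g x))
          ≡⟨ listSum-sum xs (λ i x → a i * (ys i x * g x)) ⟩
        ∑[ i < m ] (∑[ x ∈ xs ] a i * (ys i x * g x))
          ≡⟨ sum-cong-≗ (λ i → sym (*-distribˡ-listSum xs (a i) (λ x → ys i x * g x))) ⟩
        ∑[ i < m ] (a i * (∑[ x ∈ xs ] ys i x * g x)) ∎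
      where open ≡-Reasoning

    orthogonal-linComb : ∀ xs {m q} (ys : Fin m → X → ℚ) (zs : Fin q → X → ℚ) →
      (∀ i j → ∑[ x ∈ xs ] ys i x * zs j x ≡ 0ℚ) →
      ∀ a b → ∑[ x ∈ xs ] linComb a ys x * linComb b zs x ≡ 0ℚ
    orthogonal-linComb xs {m} {q} ys zs ys⊥zs a b = begin
        ∑[ x ∈ xs ] linComb a ys x * linComb b zs x
          ≡⟨ listSum-linComb-* xs a ys (linComb b zs) ⟩
        ∑[ i < m ] (a i * (∑[ x ∈ xs ] ys i x * linComb b zs x))
          ≡⟨ sum-cong-≗ (λ i → cong (a i *_) (begin
               ∑[ x ∈ xs ] ys i x * linComb b zs x
                 ≡⟨ listSum-cong-≗ xs (λ x → *-comm (ys i x) (linComb b zs x)) ⟩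
               ∑[ x ∈ xs ] linComb b zs x * ys i x
                 ≡⟨ listSum-linComb-* xs b zs (ys i) ⟩
               ∑[ j < q ] (b j * (∑[ x ∈ xs ] zs j x * ys i x))
                 ≡⟨ sum-cong-≗ (λ j → cong (b j *_) (trans (listSum-cong-≗ xs (λ x → *-comm (zs j x) (ys i x)))
                                                           (ys⊥zs i j))) ⟩
               ∑[ j < q ] (b j * 0ℚ)
                 ≡⟨ sum-zeros (λ j → *-zeroʳ (b j)) ⟩
               0ℚ ∎)) ⟩
        ∑[ i < m ] (a i * 0ℚ)
          ≡⟨ sum-zeros (λ i → *-zeroʳ (a i)) ⟩
        0ℚ ∎
      where open ≡-Reasoning

    -- A dependency among ys and zs has a zs-part orthogonal to itself, which therefore vanishes.
    orthogonal-to-independent⇒dependent : ∀ xs {m q} (ys : Fin m → X → ℚ) (zs : Fin q → X → ℚ) →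
      Independent xs q zs → (∀ i j → ∑[ x ∈ xs ] ys i x * zs j x ≡ 0ℚ) →
      length xs ℕ.< m ℕ.+ q → Dependent xs m ys
    orthogonal-to-independent⇒dependent xs {m} {q} ys zs zs-indep ys⊥zs |xs|<m+q = a , a≢0 , Y≡0
      where
        ws : Fin (m ℕ.+ q) → X → ℚ
        ws k = [ ys , zs ]′ (splitAt m k)

        dependency = more-vectors-than-coordinates⇒dependent xs ws |xs|<m+q
        e = proj₁ dependency

        a : Fin m → ℚ
        a i = e (i ↑ˡ q)
        b : Fin q → ℚ
        b j = e (m ↑ʳ j)
        Y = linComb a ys
        Z = linComb b zs

        Y+Z≡0 : VanishesOn xs (λ x → Y x + Z x)
        Y+Z≡0 {x} x∈xs = begin
            Y x + Z x
              ≡⟨ cong₂ _+_ (sum-cong-≗ (λ i → cong (λ w → a i * w x) (sym (cong [ ys , zs ]′ (splitAt-↑ˡ m i q)))))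
                           (sum-cong-≗ (λ j → cong (λ w → b j * w x) (sym (cong [ ys , zs ]′ (splitAt-↑ʳ m q j))))) ⟩
            ∑[ i < m ] (e (i ↑ˡ q) * ws (i ↑ˡ q) x) + ∑[ j < q ] (e (m ↑ʳ j) * ws (m ↑ʳ j) x)
              ≡⟨ sym (sum-↑ m (λ k → e k * ws k x)) ⟩
            linComb e ws x
              ≡⟨ proj₂ (proj₂ dependency) x∈xs ⟩
            0ℚ ∎
          where open ≡-Reasoning

        Z≡0 : VanishesOn xs Z
        Z≡0 = listSum-squares≡0⇒vanishes xs Z (begin
            ∑[ x ∈ xs ] Z x * Z x
              ≡⟨ listSum-cong xs (λ {x} x∈xs → solve 2 (λ y z → z :* z := (y :+ z) :* z :- y :* z) refl (Y x) (Z x)) ⟩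
            ∑[ x ∈ xs ] ((Y x + Z x) * Z x - Y x * Z x)
              ≡⟨ listSum-distrib-- xs (λ x → (Y x + Z x) * Z x) (λ x → Y x * Z x) ⟩
            (∑[ x ∈ xs ] (Y x + Z x) * Z x) - (∑[ x ∈ xs ] Y x * Z x)
              ≡⟨ cong₂ _-_ (vanishes⇒listSum≡0 xs (λ {x} x∈xs → trans (cong (_* Z x) (Y+Z≡0 x∈xs)) (*-zeroˡ (Z x))))
                           (orthogonal-linComb xs ys zs ys⊥zs a b) ⟩
            0ℚ - 0ℚ
              ≡⟨ +-inverseʳ 0ℚ ⟩
            0ℚ ∎)
          where open ≡-Reasoning

        Y≡0 : VanishesOn xs Y
        Y≡0 {x} x∈xs = begin
            Y x                 ≡⟨ solve 2 (λ y z → y := (y :+ z) :- z) refl (Y x) (Z x) ⟩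
            (Y x + Z x) - Z x   ≡⟨ cong₂ _-_ (Y+Z≡0 x∈xs) (Z≡0 x∈xs) ⟩
            0ℚ - 0ℚ             ≡⟨ +-inverseʳ 0ℚ ⟩
            0ℚ                  ∎
          where open ≡-Reasoning

        a-nonzero : ∀ k → e k ≢ 0ℚ → Σ (Fin m) λ i → a i ≢ 0ℚ
        a-nonzero k eₖ≢0 with splitAt m {q} k in eq
        ... | inj₁ i = i , eₖ≢0 ∘ trans (cong e (sym (splitAt⁻¹-↑ˡ eq)))
        ... | inj₂ j = ⊥-elim (eₖ≢0 (trans (cong e (sym (splitAt⁻¹-↑ʳ eq))) (zs-indep b Z≡0 j)))

        a≢0 = a-nonzero (proj₁ (proj₁ (proj₂ dependency))) (proj₂ (proj₁ (proj₂ dependency)))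

  listSum-map : ∀ {A B : Set} (f : A → B) xs (g : B → ℚ) → listSum (map f xs) g ≡ ∑[ x ∈ xs ] g (f x)
  listSum-map f [] g = refl
  listSum-map f (x ∷ xs) g = cong (λ s → g (f x) + s) (listSum-map f xs g)

  listSum-++ : ∀ {X : Set} (xs ys : List X) g → listSum (xs ++ ys) g ≡ listSum xs g + listSum ys g
  listSum-++ [] ys g = sym (+-identityˡ (listSum ys g))
  listSum-++ (x ∷ xs) ys g = trans (cong (λ s → g x + s) (listSum-++ xs ys g)) (sym (+-assoc (g x) _ _))

  -- Counting transversals

  subsetsOfSize : (t k : ℕ) → List (Subset t)
  subsetsOfSize zero zero = [] ∷ []
  subsetsOfSize zero (suc k) = []
  subsetsOfSize (suc t) zero = map (outside ∷_) (subsetsOfSize t zero)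
  subsetsOfSize (suc t) (suc k) = map (inside ∷_) (subsetsOfSize t k) ++ map (outside ∷_) (subsetsOfSize t (suc k))

  length-subsetsOfSize : ∀ t k → length (subsetsOfSize t k) ≡ t C k
  length-subsetsOfSize zero zero = refl
  length-subsetsOfSize zero (suc k) = refl
  length-subsetsOfSize (suc t) zero = trans (length-map (outside ∷_) (subsetsOfSize t zero)) (length-subsetsOfSize t zero)
  length-subsetsOfSize (suc t) (suc k) = begin
      length (map (inside ∷_) (subsetsOfSize t k) ++ map (outside ∷_) (subsetsOfSize t (suc k)))
        ≡⟨ length-++ (map (inside ∷_) (subsetsOfSize t k)) ⟩
      length (map (inside ∷_) (subsetsOfSize t k)) ℕ.+ length (map (outside ∷_) (subsetsOfSize t (suc k)))
        ≡⟨ cong₂ ℕ._+_ (trans (length-map (inside ∷_) (subsetsOfSize t k)) (length-subsetsOfSize t k))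
                       (trans (length-map (outside ∷_) (subsetsOfSize t (suc k))) (length-subsetsOfSize t (suc k))) ⟩
      t C k ℕ.+ t C suc k
        ≡⟨ nCk+nC[k+1]≡[n+1]C[k+1] t k ⟩
      suc t C suc k ∎
    where open ≡-Reasoning

  size⇒∈subsetsOfSize : ∀ {t k} (S : Subset t) → ∣ S ∣ ≡ k → S ∈ subsetsOfSize t k
  size⇒∈subsetsOfSize {zero} {zero} [] _ = here refl
  size⇒∈subsetsOfSize {suc t} {zero} (false ∷ S) |S|≡0 = ∈-map⁺ (outside ∷_) (size⇒∈subsetsOfSize S |S|≡0)
  size⇒∈subsetsOfSize {suc t} {suc k} (true ∷ S) |S|≡k =
    ∈-++⁺ˡ (∈-map⁺ (inside ∷_) (size⇒∈subsetsOfSize S (ℕₚ.suc-injective |S|≡k)))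
  size⇒∈subsetsOfSize {suc t} {suc k} (false ∷ S) |S|≡k =
    ∈-++⁺ʳ (map (inside ∷_) (subsetsOfSize t k)) (∈-map⁺ (outside ∷_) (size⇒∈subsetsOfSize S |S|≡k))

  listSum-subsetsOfSize-zero : ∀ t (g : Subset (suc t) → ℚ) →
    listSum (subsetsOfSize (suc t) zero) g ≡ ∑[ S ∈ subsetsOfSize t zero ] g (outside ∷ S)
  listSum-subsetsOfSize-zero t = listSum-map (outside ∷_) (subsetsOfSize t zero)

  listSum-subsetsOfSize-suc : ∀ t k (g : Subset (suc t) → ℚ) →
    listSum (subsetsOfSize (suc t) (suc k)) g ≡
      listSum (subsetsOfSize t k) (λ S → g (inside ∷ S)) + listSum (subsetsOfSize t (suc k)) (λ S → g (outside ∷ S))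
  listSum-subsetsOfSize-suc t k g = trans (listSum-++ (map (inside ∷_) (subsetsOfSize t k)) _ g)
    (cong₂ _+_ (listSum-map (inside ∷_) (subsetsOfSize t k) g) (listSum-map (outside ∷_) (subsetsOfSize t (suc k)) g))

  𝟙-allFin : ∀ k (g : Fin k → Bool) → 𝟙 (allFin k g) ≡ prod (𝟙 ∘ g)
  𝟙-allFin zero g = refl
  𝟙-allFin (suc k) g = trans (𝟙-∧ (g zero) _) (cong (𝟙 (g zero) *_) (𝟙-allFin k (g ∘ suc)))

  bit : Bool → ℕ
  bit b = if b then 1 else 0

  count : ∀ {k} → (Fin k → Bool) → ℕ
  count τ = ℕsum (bit ∘ τ)

  clear : ∀ {k} → Fin k → (Fin k → Bool) → Fin k → Bool
  clear j τ i = if ⌊ j Fin.≟ i ⌋ then false else τ i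

  clear-self : ∀ {k} (j : Fin k) τ → clear j τ j ≡ false
  clear-self j τ = cong (if_then false else τ j) (⌊≟⌋-refl j)

  clear-punchIn : ∀ {k} (j : Fin (suc k)) τ i → clear j τ (punchIn j i) ≡ τ (punchIn j i)
  clear-punchIn j τ i = cong (if_then false else τ (punchIn j i)) (⌊≟⌋-≢ (punchInᵢ≢i j i ∘ sym))

  count-clear : ∀ {k} (τ : Fin (suc k) → Bool) j → count τ ≡ bit (τ j) ℕ.+ count (clear j τ)
  count-clear τ j = begin
      count τ
        ≡⟨ ℕsum-remove {i = j} (bit ∘ τ) ⟩
      bit (τ j) ℕ.+ ℕsum (bit ∘ τ ∘ punchIn j)
        ≡⟨ cong (bit (τ j) ℕ.+_) (ℕsum-cong-≗ (cong bit ∘ sym ∘ clear-punchIn j τ)) ⟩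
      bit (τ j) ℕ.+ ℕsum (bit ∘ clear j τ ∘ punchIn j)
        ≡⟨ cong (bit (τ j) ℕ.+_) (sym count-clear-self) ⟩
      bit (τ j) ℕ.+ count (clear j τ) ∎
    where
      open ≡-Reasoning
      count-clear-self : count (clear j τ) ≡ ℕsum (bit ∘ clear j τ ∘ punchIn j)
      count-clear-self = trans (ℕsum-remove {i = j} (bit ∘ clear j τ))
                               (cong (λ b → bit b ℕ.+ ℕsum (bit ∘ clear j τ ∘ punchIn j)) (clear-self j τ))

  -- The pattern τ generalises the transversal condition (τ ≡ true) so that the induction on t goes
  -- through: once the first point is put in S, its part must not be met again.
  fits : ∀ {t k} → (Fin t → Fin k) → (Fin k → Bool) → Subset t → Bool
  fits {k = k} f τ S = allFin k (λ i → ∣ S ∩ part f i ∣ ℕ.≡ᵇ bit (τ i))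

  fits-inside : ∀ {t k} (f : Fin (suc t) → Fin (suc k)) τ S →
    𝟙 (fits f τ (inside ∷ S)) ≡ 𝟙 (τ (f zero)) * 𝟙 (fits (f ∘ suc) (clear (f zero) τ) S)
  fits-inside {k = k} f τ S = begin
      𝟙 (fits f τ (inside ∷ S))
        ≡⟨ 𝟙-allFin (suc k) g ⟩
      prod (𝟙 ∘ g)
        ≡⟨ prod-remove {i = j} (𝟙 ∘ g) ⟩
      𝟙 (g j) * prod (𝟙 ∘ g ∘ punchIn j)
        ≡⟨ cong₂ (λ a b → 𝟙 a * b) gⱼ (prod-cong-≗ (cong 𝟙 ∘ g∘punchIn)) ⟩
      𝟙 (τ j ∧ h j) * prod (𝟙 ∘ h ∘ punchIn j)
        ≡⟨ cong (_* prod (𝟙 ∘ h ∘ punchIn j)) (𝟙-∧ (τ j) (h j)) ⟩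
      𝟙 (τ j) * 𝟙 (h j) * prod (𝟙 ∘ h ∘ punchIn j)
        ≡⟨ *-assoc (𝟙 (τ j)) (𝟙 (h j)) _ ⟩
      𝟙 (τ j) * (𝟙 (h j) * prod (𝟙 ∘ h ∘ punchIn j))
        ≡⟨ cong (𝟙 (τ j) *_) (sym (trans (𝟙-allFin (suc k) h) (prod-remove {i = j} (𝟙 ∘ h)))) ⟩
      𝟙 (τ j) * 𝟙 (fits (f ∘ suc) (clear j τ) S) ∎
    where
      open ≡-Reasoning
      j = f zero
      g : Fin (suc k) → Bool
      g i = ∣ ⌊ j Fin.≟ i ⌋ ∷ (S ∩ part (f ∘ suc) i) ∣ ℕ.≡ᵇ bit (τ i)
      h : Fin (suc k) → Bool
      h i = ∣ S ∩ part (f ∘ suc) i ∣ ℕ.≡ᵇ bit (clear j τ i)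
      suc≡ᵇbit : ∀ r b → (suc r ℕ.≡ᵇ bit b) ≡ b ∧ (r ℕ.≡ᵇ 0)
      suc≡ᵇbit r true = refl
      suc≡ᵇbit r false = refl
      gⱼ : g j ≡ τ j ∧ h j
      gⱼ = trans (cong (λ a → ∣ a ∷ (S ∩ part (f ∘ suc) j) ∣ ℕ.≡ᵇ bit (τ j)) (⌊≟⌋-refl j))
         (trans (suc≡ᵇbit _ (τ j))
                (cong (λ b → τ j ∧ (∣ S ∩ part (f ∘ suc) j ∣ ℕ.≡ᵇ bit b)) (sym (clear-self j τ))))
      g∘punchIn : ∀ i → g (punchIn j i) ≡ h (punchIn j i)
      g∘punchIn i = cong₂ (λ a b → ∣ a ∷ (S ∩ part (f ∘ suc) (punchIn j i)) ∣ ℕ.≡ᵇ bit b)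
        (⌊≟⌋-≢ (punchInᵢ≢i j i ∘ sym)) (sym (clear-punchIn j τ i))

  weight : ∀ {t} → (Fin t → ℚ) → Subset t → ℚ
  weight w [] = 1ℚ
  weight w (true ∷ S) = w zero * weight (w ∘ suc) S
  weight w (false ∷ S) = weight (w ∘ suc) S

  partWeight : ∀ {t k} → (Fin t → Fin k) → (Fin t → ℚ) → Fin k → ℚ
  partWeight {t} f w i = ∑[ x < t ] (𝟙 ⌊ f x Fin.≟ i ⌋ * w x)

  patternWeight : ∀ {t k} → (Fin t → Fin k) → (Fin t → ℚ) → (Fin k → Bool) → ℚ
  patternWeight f w τ = prod (λ i → if τ i then partWeight f w i else 1ℚ)

  patternWeight-suc : ∀ {t k} (f : Fin (suc t) → Fin (suc k)) w τ →
    patternWeight f w τ ≡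
      patternWeight (f ∘ suc) (w ∘ suc) τ + 𝟙 (τ (f zero)) * w zero * patternWeight (f ∘ suc) (w ∘ suc) (clear (f zero) τ)
  patternWeight-suc {k = k} f w τ = begin
      prod (factor τ s)
        ≡⟨ prod-remove {i = j} (factor τ s) ⟩
      factor τ s j * prod (factor τ s ∘ punchIn j)
        ≡⟨ cong₂ (λ a r → (if τ j then a else 1ℚ) * r) sⱼ
                 (prod-cong-≗ (λ i → cong (if τ (punchIn j i) then_else 1ℚ) (s∘punchIn i))) ⟩
      (if τ j then w zero + s′ j else 1ℚ) * R
        ≡⟨ split (τ j) (w zero) (s′ j) R ⟩
      factor τ s′ j * R + 𝟙 (τ j) * w zero * (1ℚ * R)
        ≡⟨ cong₂ (λ a b → a + 𝟙 (τ j) * w zero * b) (sym (prod-remove {i = j} (factor τ s′)))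
             (cong₂ (λ b r → (if b then s′ j else 1ℚ) * r) (sym (clear-self j τ))
                    (prod-cong-≗ (λ i → cong (if_then s′ (punchIn j i) else 1ℚ) (sym (clear-punchIn j τ i))))) ⟩
      prod (factor τ s′) + 𝟙 (τ j) * w zero * (factor (clear j τ) s′ j * prod (factor (clear j τ) s′ ∘ punchIn j))
        ≡⟨ cong (λ r → prod (factor τ s′) + 𝟙 (τ j) * w zero * r) (sym (prod-remove {i = j} (factor (clear j τ) s′))) ⟩
      prod (factor τ s′) + 𝟙 (τ j) * w zero * prod (factor (clear j τ) s′) ∎
    where
      open ≡-Reasoning
      j = f zero
      s = partWeight f w
      s′ = partWeight (f ∘ suc) (w ∘ suc)
      factor : (Fin (suc k) → Bool) → (Fin (suc k) → ℚ) → Fin (suc k) → ℚ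
      factor σ u i = if σ i then u i else 1ℚ
      R = prod (factor τ s′ ∘ punchIn j)
      sⱼ : s j ≡ w zero + s′ j
      sⱼ = trans (cong (λ b → 𝟙 b * w zero + s′ j) (⌊≟⌋-refl j)) (cong (_+ s′ j) (*-identityˡ (w zero)))
      s∘punchIn : ∀ i → s (punchIn j i) ≡ s′ (punchIn j i)
      s∘punchIn i = trans (cong (λ b → 𝟙 b * w zero + s′ (punchIn j i)) (⌊≟⌋-≢ (punchInᵢ≢i j i ∘ sym)))
                          (trans (cong (_+ s′ (punchIn j i)) (*-zeroˡ (w zero))) (+-identityˡ _))
      split : ∀ b a u r → (if b then a + u else 1ℚ) * r ≡ (if b then u else 1ℚ) * r + 𝟙 b * a * (1ℚ * r)
      split true = solve 3 (λ a u r → (a :+ u) :* r := u :* r :+ con 1ℚ :* a :* (con 1ℚ :* r)) refl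
      split false = solve 3 (λ a u r → con 1ℚ :* r := con 1ℚ :* r :+ con 0ℚ :* a :* (con 1ℚ :* r)) refl

  listSum-fits-inside : ∀ {t k} (f : Fin (suc t) → Fin (suc k)) w τ j →
    ∑[ S ∈ subsetsOfSize t j ] 𝟙 (fits f τ (inside ∷ S)) * weight w (inside ∷ S) ≡
      𝟙 (τ (f zero)) * w zero * (∑[ S ∈ subsetsOfSize t j ] 𝟙 (fits (f ∘ suc) (clear (f zero) τ) S) * weight (w ∘ suc) S)
  listSum-fits-inside {t} f w τ j = trans
    (listSum-cong-≗ (subsetsOfSize t j) (λ S → trans (cong (_* weight w (inside ∷ S)) (fits-inside f τ S))
      (solve 4 (λ b e a x → b :* e :* (a :* x) := b :* a :* (e :* x)) refl
             (𝟙 (τ (f zero))) (𝟙 (fits (f ∘ suc) (clear (f zero) τ) S)) (w zero) (weight (w ∘ suc) S))))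
    (sym (*-distribˡ-listSum (subsetsOfSize t j) (𝟙 (τ (f zero)) * w zero) _))

  prod-absent : ∀ {k} (τ : Fin k → Bool) → prod (λ i → if τ i then 0ℚ else 1ℚ) ≡ 𝟙 (count τ ℕ.≡ᵇ 0)
  prod-absent {zero} τ = refl
  prod-absent {suc k} τ with τ zero
  ... | true = *-zeroˡ (prod (λ i → if τ (suc i) then 0ℚ else 1ℚ))
  ... | false = trans (*-identityˡ _) (prod-absent (τ ∘ suc))

  fits-[] : ∀ {k} (f : Fin 0 → Fin k) τ → 𝟙 (fits f τ []) ≡ 𝟙 (count τ ℕ.≡ᵇ 0)
  fits-[] {k} f τ = trans (𝟙-allFin k _) (trans (prod-cong-≗ (λ i → absent (τ i))) (prod-absent τ))
    where absent : ∀ b → 𝟙 (0 ℕ.≡ᵇ bit b) ≡ (if b then 0ℚ else 1ℚ)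
          absent true = refl
          absent false = refl

  count-fitting-[] : ∀ {k} (f : Fin 0 → Fin k) (w : Fin 0 → ℚ) j τ →
    ∑[ S ∈ subsetsOfSize 0 j ] 𝟙 (fits f τ S) * weight w S ≡ 𝟙 (j ℕ.≡ᵇ count τ) * patternWeight f w τ
  count-fitting-[] f w zero τ rewrite prod-absent τ =
    trans (+-identityʳ _) (trans (*-identityʳ _) (trans (fits-[] f τ) (only-zero (count τ))))
    where only-zero : ∀ c → 𝟙 (c ℕ.≡ᵇ 0) ≡ 𝟙 (0 ℕ.≡ᵇ c) * 𝟙 (c ℕ.≡ᵇ 0)
          only-zero zero = refl
          only-zero (suc c) = refl
  count-fitting-[] f w (suc j) τ rewrite prod-absent τ = sym (never (count τ))
    where never : ∀ c → 𝟙 (suc j ℕ.≡ᵇ c) * 𝟙 (c ℕ.≡ᵇ 0) ≡ 0ℚ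
          never zero = refl
          never (suc c) = *-zeroʳ (𝟙 (j ℕ.≡ᵇ c))

  count-fitting : ∀ t {k} (f : Fin t → Fin k) (w : Fin t → ℚ) j τ →
    ∑[ S ∈ subsetsOfSize t j ] 𝟙 (fits f τ S) * weight w S ≡ 𝟙 (j ℕ.≡ᵇ count τ) * patternWeight f w τ
  count-fitting zero f w j τ = count-fitting-[] f w j τ
  count-fitting (suc t) {zero} f with f zero
  ... | ()
  count-fitting (suc t) {suc k} f w zero τ = begin
      ∑[ S ∈ subsetsOfSize (suc t) 0 ] 𝟙 (fits f τ S) * weight w S
        ≡⟨ listSum-subsetsOfSize-zero t _ ⟩
      ∑[ S ∈ subsetsOfSize t 0 ] 𝟙 (fits (f ∘ suc) τ S) * weight (w ∘ suc) S
        ≡⟨ count-fitting t (f ∘ suc) (w ∘ suc) zero τ ⟩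
      𝟙 (0 ℕ.≡ᵇ count τ) * P
        ≡⟨ cong (λ c → 𝟙 (0 ℕ.≡ᵇ c) * P) (count-clear τ j) ⟩
      𝟙 (0 ℕ.≡ᵇ bit (τ j) ℕ.+ count (clear j τ)) * P
        ≡⟨ unfitting (τ j) (count (clear j τ)) ⟩
      𝟙 (0 ℕ.≡ᵇ bit (τ j) ℕ.+ count (clear j τ)) * (P + 𝟙 (τ j) * w zero * P′)
        ≡⟨ cong₂ (λ c q → 𝟙 (0 ℕ.≡ᵇ c) * q) (sym (count-clear τ j)) (sym (patternWeight-suc f w τ)) ⟩
      𝟙 (0 ℕ.≡ᵇ count τ) * patternWeight f w τ ∎
    where
      open ≡-Reasoning
      j = f zero
      P = patternWeight (f ∘ suc) (w ∘ suc) τ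
      P′ = patternWeight (f ∘ suc) (w ∘ suc) (clear j τ)
      unfitting : ∀ b c → 𝟙 (0 ℕ.≡ᵇ bit b ℕ.+ c) * P ≡ 𝟙 (0 ℕ.≡ᵇ bit b ℕ.+ c) * (P + 𝟙 b * w zero * P′)
      unfitting true c = trans (*-zeroˡ P) (sym (*-zeroˡ (P + 1ℚ * w zero * P′)))
      unfitting false c = cong (𝟙 (0 ℕ.≡ᵇ c) *_)
        (solve 3 (λ p a q → p := p :+ con 0ℚ :* a :* q) refl P (w zero) P′)
  count-fitting (suc t) {suc k} f w (suc j′) τ = begin
      ∑[ S ∈ subsetsOfSize (suc t) (suc j′) ] 𝟙 (fits f τ S) * weight w S
        ≡⟨ listSum-subsetsOfSize-suc t j′ _ ⟩
      (∑[ S ∈ subsetsOfSize t j′ ] 𝟙 (fits f τ (inside ∷ S)) * weight w (inside ∷ S))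
        + (∑[ S ∈ subsetsOfSize t (suc j′) ] 𝟙 (fits (f ∘ suc) τ S) * weight (w ∘ suc) S)
        ≡⟨ cong₂ _+_ (trans (listSum-fits-inside f w τ j′)
                            (cong (𝟙 (τ j) * w zero *_) (count-fitting t (f ∘ suc) (w ∘ suc) j′ (clear j τ))))
                     (count-fitting t (f ∘ suc) (w ∘ suc) (suc j′) τ) ⟩
      𝟙 (τ j) * w zero * (𝟙 (j′ ℕ.≡ᵇ count (clear j τ)) * P′) + 𝟙 (suc j′ ℕ.≡ᵇ count τ) * P
        ≡⟨ cong (λ c → 𝟙 (τ j) * w zero * (𝟙 (j′ ℕ.≡ᵇ count (clear j τ)) * P′) + 𝟙 (suc j′ ℕ.≡ᵇ c) * P)
                (count-clear τ j) ⟩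
      𝟙 (τ j) * w zero * (𝟙 (j′ ℕ.≡ᵇ count (clear j τ)) * P′)
        + 𝟙 (suc j′ ℕ.≡ᵇ bit (τ j) ℕ.+ count (clear j τ)) * P
        ≡⟨ fitting (τ j) (count (clear j τ)) ⟩
      𝟙 (suc j′ ℕ.≡ᵇ bit (τ j) ℕ.+ count (clear j τ)) * (P + 𝟙 (τ j) * w zero * P′)
        ≡⟨ cong₂ (λ c q → 𝟙 (suc j′ ℕ.≡ᵇ c) * q) (sym (count-clear τ j)) (sym (patternWeight-suc f w τ)) ⟩
      𝟙 (suc j′ ℕ.≡ᵇ count τ) * patternWeight f w τ ∎
    where
      open ≡-Reasoning
      j = f zero
      P = patternWeight (f ∘ suc) (w ∘ suc) τ
      P′ = patternWeight (f ∘ suc) (w ∘ suc) (clear j τ)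
      fitting : ∀ b c → 𝟙 b * w zero * (𝟙 (j′ ℕ.≡ᵇ c) * P′) + 𝟙 (suc j′ ℕ.≡ᵇ bit b ℕ.+ c) * P
                      ≡ 𝟙 (suc j′ ℕ.≡ᵇ bit b ℕ.+ c) * (P + 𝟙 b * w zero * P′)
      fitting true c = solve 4 (λ a e p q → con 1ℚ :* a :* (e :* q) :+ e :* p := e :* (p :+ con 1ℚ :* a :* q))
        refl (w zero) (𝟙 (j′ ℕ.≡ᵇ c)) P P′
      fitting false c = solve 5 (λ a e e′ p q → con 0ℚ :* a :* (e′ :* q) :+ e :* p := e :* (p :+ con 0ℚ :* a :* q))
        refl (w zero) (𝟙 (suc j′ ℕ.≡ᵇ c)) (𝟙 (j′ ℕ.≡ᵇ c)) P P′

  partWeight-ones : ∀ {t k} (f : Fin t → Fin k) i → partWeight f (λ _ → 1ℚ) i ≡ ι ∣ part f i ∣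
  partWeight-ones f i = trans
    (sum-cong-≗ (λ x → trans (*-identityʳ _) (cong 𝟙 (sym (lookup∘tabulate (λ y → ⌊ f y Fin.≟ i ⌋) x)))))
    (sym (ι-size (part f i)))

  weight-ones : ∀ {t} (w : Fin t → ℚ) → (∀ x → w x ≡ 1ℚ) → ∀ S → weight w S ≡ 1ℚ
  weight-ones w w≡1 [] = refl
  weight-ones w w≡1 (true ∷ S) = trans (cong₂ _*_ (w≡1 zero) (weight-ones (w ∘ suc) (w≡1 ∘ suc) S)) (*-identityˡ 1ℚ)
  weight-ones w w≡1 (false ∷ S) = weight-ones (w ∘ suc) (w≡1 ∘ suc) S

  avoid : ∀ {t} → Fin t → Fin t → ℚ
  avoid x y = 1ℚ - 𝟙 (lookup ⁅ x ⁆ y)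

  lookup⁅x⁆ : ∀ {t} (x : Fin t) y → y ≢ x → lookup ⁅ x ⁆ y ≡ false
  lookup⁅x⁆ x y y≢x with lookup ⁅ x ⁆ y in eq
  ... | true = ⊥-elim (y≢x (x∈⁅y⁆⇒x≡y x (lookup⇒[]= y ⁅ x ⁆ eq)))
  ... | false = refl

  weight-avoid : ∀ {t} (x : Fin t) S → weight (avoid x) S ≡ 1ℚ - 𝟙 (lookup S x)
  weight-avoid zero (true ∷ S) = trans (*-zeroˡ (weight (avoid zero ∘ suc) S)) (sym (+-inverseʳ 1ℚ))
  weight-avoid zero (false ∷ S) = trans (weight-ones _ (λ y → cong (λ b → 1ℚ - 𝟙 b) (lookup⁅x⁆ zero (suc y) λ ())) S)
                                        (sym (+-identityʳ 1ℚ))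
  weight-avoid (suc x) (true ∷ S) = trans (*-identityˡ _) (weight-avoid x S)
  weight-avoid (suc x) (false ∷ S) = weight-avoid x S

  partWeight-avoid : ∀ {t k} (f : Fin t → Fin k) x i →
    partWeight f (avoid x) i ≡ partWeight f (λ _ → 1ℚ) i - 𝟙 ⌊ f x Fin.≟ i ⌋
  partWeight-avoid {t} f x i = begin
      ∑[ y < t ] (a y * (1ℚ - 𝟙 (lookup ⁅ x ⁆ y)))
        ≡⟨ sum-cong-≗ (λ y → *-distribˡ-minus (a y) 1ℚ (𝟙 (lookup ⁅ x ⁆ y))) ⟩
      ∑[ y < t ] (a y * 1ℚ - a y * 𝟙 (lookup ⁅ x ⁆ y))
        ≡⟨ ∑-distrib-- (λ y → a y * 1ℚ) (λ y → a y * 𝟙 (lookup ⁅ x ⁆ y)) ⟩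
      partWeight f (λ _ → 1ℚ) i - ∑[ y < t ] (a y * 𝟙 (lookup ⁅ x ⁆ y))
        ≡⟨ cong (λ z → partWeight f (λ _ → 1ℚ) i - z) (sum-single (λ y → a y * 𝟙 (lookup ⁅ x ⁆ y)) x
             (λ y y≢x → trans (cong (λ b → a y * 𝟙 b) (lookup⁅x⁆ x y y≢x)) (*-zeroʳ (a y)))) ⟩
      partWeight f (λ _ → 1ℚ) i - a x * 𝟙 (lookup ⁅ x ⁆ x)
        ≡⟨ cong (λ b → partWeight f (λ _ → 1ℚ) i - a x * 𝟙 b) ([]=⇒lookup (x∈⁅x⁆ x)) ⟩
      partWeight f (λ _ → 1ℚ) i - a x * 1ℚ
        ≡⟨ cong (λ z → partWeight f (λ _ → 1ℚ) i - z) (*-identityʳ (a x)) ⟩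
      partWeight f (λ _ → 1ℚ) i - a x ∎
    where
      open ≡-Reasoning
      a : Fin t → ℚ
      a y = 𝟙 ⌊ f y Fin.≟ i ⌋

  listSum-transversals : ∀ {t k} (f : Fin t → Fin k) (w : Fin t → ℚ) →
    ∑[ S ∈ subsetsOfSize t k ] Aentry t k f S * weight w S ≡ prod (partWeight f w)
  -- Aentry t k f and 𝟙 ∘ fits f (λ _ → true) are definitionally equal.
  listSum-transversals {t} {k} f w = begin
      ∑[ S ∈ subsetsOfSize t k ] 𝟙 (fits f (λ _ → true) S) * weight w S
        ≡⟨ count-fitting t f w k (λ _ → true) ⟩
      𝟙 (k ℕ.≡ᵇ count {k} (λ _ → true)) * prod (partWeight f w)
        ≡⟨ cong (λ c → 𝟙 (k ℕ.≡ᵇ c) * prod (partWeight f w)) (count-true k) ⟩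
      𝟙 (k ℕ.≡ᵇ k) * prod (partWeight f w)
        ≡⟨ cong (λ b → 𝟙 b * prod (partWeight f w)) (≡ᵇ-refl k) ⟩
      1ℚ * prod (partWeight f w)
        ≡⟨ *-identityˡ _ ⟩
      prod (partWeight f w) ∎
    where
      open ≡-Reasoning
      count-true : ∀ k → count {k} (λ _ → true) ≡ k
      count-true zero = refl
      count-true (suc k) = cong suc (count-true k)

  module _ {t k m} (f : Fin t → Fin k) (f-parts : IsOrdPart (λ _ → m) f) where

    transversal-count : ∑[ S ∈ subsetsOfSize t k ] Aentry t k f S ≡ ι m ^ k
    transversal-count = begin
        ∑[ S ∈ subsetsOfSize t k ] Aentry t k f S
          ≡⟨ listSum-cong-≗ (subsetsOfSize t k) (λ S → sym (trans (cong (Aentry t k f S *_) (weight-ones _ (λ _ → refl) S))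
                                                                   (*-identityʳ _))) ⟩
        ∑[ S ∈ subsetsOfSize t k ] Aentry t k f S * weight (λ _ → 1ℚ) S
          ≡⟨ listSum-transversals f (λ _ → 1ℚ) ⟩
        prod (partWeight f (λ _ → 1ℚ))
          ≡⟨ prod-cong-≗ (λ i → trans (partWeight-ones f i) (cong ι (f-parts i))) ⟩
        prod {k} (λ _ → ι m)
          ≡⟨ prod-replicate k ⟩
        ι m ^ k ∎
      where open ≡-Reasoning

  -- Transversals through x are counted as all transversals minus those avoiding x, the latter being
  -- the generating function for the weight avoid x.
  transversal-count-through : ∀ {t k m} (f : Fin t → Fin (suc k)) → IsOrdPart (λ _ → m) f → ∀ x →
    ∑[ S ∈ subsetsOfSize t (suc k) ] Aentry t (suc k) f S * 𝟙 (lookup S x) ≡ ι m ^ k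
  transversal-count-through {t} {k} {m} f f-parts x = begin
      ∑[ S ∈ Ss ] A S * 𝟙 (lookup S x)
        ≡⟨ listSum-cong-≗ Ss (λ S → trans (solve 2 (λ a e → a :* e := a :- a :* (con 1ℚ :- e)) refl (A S) (𝟙 (lookup S x)))
                                          (cong (λ w → A S - A S * w) (sym (weight-avoid x S)))) ⟩
      ∑[ S ∈ Ss ] (A S - A S * weight (avoid x) S)
        ≡⟨ listSum-distrib-- Ss A (λ S → A S * weight (avoid x) S) ⟩
      (∑[ S ∈ Ss ] A S) - (∑[ S ∈ Ss ] A S * weight (avoid x) S)
        ≡⟨ cong₂ _-_ (transversal-count f f-parts) (listSum-transversals f (avoid x)) ⟩
      ι m ^ suc k - prod (partWeight f (avoid x))
        ≡⟨ cong (λ z → ι m ^ suc k - z) (begin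
             prod (partWeight f (avoid x))
               ≡⟨ prod-remove {i = f x} (partWeight f (avoid x)) ⟩
             partWeight f (avoid x) (f x) * prod (partWeight f (avoid x) ∘ punchIn (f x))
               ≡⟨ cong₂ _*_ (trans (avoid-part (f x)) (cong (λ b → ι m - 𝟙 b) (⌊≟⌋-refl (f x))))
                            (trans (prod-cong-≗ (λ i → trans (avoid-part (punchIn (f x) i))
                                      (trans (cong (λ b → ι m - 𝟙 b) (⌊≟⌋-≢ (punchInᵢ≢i (f x) i ∘ sym)))
                                             (+-identityʳ (ι m)))))
                                   (prod-replicate k)) ⟩
             (ι m - 1ℚ) * ι m ^ k ∎) ⟩
      ι m * ι m ^ k - (ι m - 1ℚ) * ι m ^ k
        ≡⟨ solve 2 (λ a p → a :* p :- (a :- con 1ℚ) :* p := p) refl (ι m) (ι m ^ k) ⟩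
      ι m ^ k ∎
    where
      open ≡-Reasoning
      Ss = subsetsOfSize t (suc k)
      A = Aentry t (suc k) f
      avoid-part : ∀ i → partWeight f (avoid x) i ≡ ι m - 𝟙 ⌊ f x Fin.≟ i ⌋
      avoid-part i = trans (partWeight-avoid f x i)
                           (cong (_- 𝟙 ⌊ f x Fin.≟ i ⌋) (trans (partWeight-ones f i) (cong ι (f-parts i))))

  transversal-count-meeting : ∀ {t k m} (f : Fin t → Fin (suc k)) → IsOrdPart (λ _ → m) f → ∀ B →
    ∑[ S ∈ subsetsOfSize t (suc k) ] Aentry t (suc k) f S * ι ∣ S ∩ B ∣ ≡ ι ∣ B ∣ * ι m ^ k
  transversal-count-meeting {t} {k} {m} f f-parts B = begin
      ∑[ S ∈ Ss ] A S * ι ∣ S ∩ B ∣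
        ≡⟨ listSum-cong-≗ Ss (λ S → trans (cong (A S *_) (ι-size-∩ S B))
             (trans (*-distribˡ-sum (A S) (λ x → 𝟙 (lookup S x) * 𝟙 (lookup B x)))
                    (sum-cong-≗ (λ x → solve 3 (λ a s b → a :* (s :* b) := b :* (a :* s)) refl
                                               (A S) (𝟙 (lookup S x)) (𝟙 (lookup B x)))))) ⟩
      ∑[ S ∈ Ss ] ∑[ x < t ] (𝟙 (lookup B x) * (A S * 𝟙 (lookup S x)))
        ≡⟨ listSum-sum Ss (λ x S → 𝟙 (lookup B x) * (A S * 𝟙 (lookup S x))) ⟩
      ∑[ x < t ] (∑[ S ∈ Ss ] 𝟙 (lookup B x) * (A S * 𝟙 (lookup S x)))
        ≡⟨ sum-cong-≗ (λ x → trans (sym (*-distribˡ-listSum Ss (𝟙 (lookup B x)) (λ S → A S * 𝟙 (lookup S x))))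
                                   (cong (𝟙 (lookup B x) *_) (transversal-count-through f f-parts x))) ⟩
      ∑[ x < t ] (𝟙 (lookup B x) * ι m ^ k)
        ≡⟨ sym (*-distribʳ-sum (ι m ^ k) (λ x → 𝟙 (lookup B x))) ⟩
      (∑[ x < t ] 𝟙 (lookup B x)) * ι m ^ k
        ≡⟨ cong (_* ι m ^ k) (sym (ι-size B)) ⟩
      ι ∣ B ∣ * ι m ^ k ∎
    where
      open ≡-Reasoning
      Ss = subsetsOfSize t (suc k)
      A = Aentry t (suc k) f

  2p/k*n≡p*m : ∀ {k m n} p → n ℕ.+ n ≡ suc k ℕ.* m → ((((ℤ.+ 2) ℚ./ 1) * p) /ℕ suc k) * ι n ≡ p * ι m
  2p/k*n≡p*m {k} {m} {n} p n+n≡km = begin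
      ((ℤ.+ 2) ℚ./ 1 * p) * invK * ι n   ≡⟨ cong (λ two → two * p * invK * ι n) ([+n]/1≡ι 2) ⟩
      ι 2 * p * invK * ι n
        ≡⟨ solve 3 (λ p i x → con (ι 2) :* p :* i :* x := p :* i :* (x :+ x)) refl p invK (ι n) ⟩
      p * invK * (ι n + ι n)             ≡⟨ cong (λ x → p * invK * x) (sym (×-homo-+ 1ℚ n n)) ⟩
      p * invK * ι (n ℕ.+ n)             ≡⟨ cong (λ x → p * invK * ι x) n+n≡km ⟩
      p * invK * ι (suc k ℕ.* m)         ≡⟨ cong (λ x → p * invK * x) (×1-homo-* (suc k) m) ⟩
      p * invK * (ι (suc k) * ι m)       ≡⟨ solve 4 (λ p i K m → p :* i :* (K :* m) := p :* (i :* K) :* m) refl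
                                                    p invK (ι (suc k)) (ι m) ⟩
      p * (invK * ι (suc k)) * ι m       ≡⟨ cong (λ x → p * x * ι m) ([1/n]*ι[n]≡1 k) ⟩
      p * 1ℚ * ι m                       ≡⟨ cong (_* ι m) (*-identityʳ p) ⟩
      p * ι m                            ∎
    where
      open ≡-Reasoning
      invK = (ℤ.+ 1) ℚ./ suc k

  row-orthogonal : ∀ {t k m} (f : Fin t → Fin (suc k)) → IsOrdPart (λ _ → m) f → ∀ p B →
    ∣ B ∣ ℕ.+ ∣ B ∣ ≡ suc k ℕ.* m →
    ∑[ S ∈ subsetsOfSize t (suc k) ] Aentry t (suc k) f S * (vVec t (suc k) p B S - uVec t p (suc k) S) ≡ 0ℚ
  row-orthogonal {t} {k} {m} f f-parts p B |B|+|B|≡km = begin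
      ∑[ S ∈ Ss ] A S * (c * ((ℤ.+ ∣ S ∩ B ∣) ℚ./ 1) - p)
        ≡⟨ listSum-cong-≗ Ss (λ S → trans (cong (λ x → A S * (c * x - p)) ([+n]/1≡ι ∣ S ∩ B ∣))
             (solve 4 (λ a c x p → a :* (c :* x :- p) := c :* (a :* x) :- p :* a) refl (A S) c (ι ∣ S ∩ B ∣) p)) ⟩
      ∑[ S ∈ Ss ] (c * (A S * ι ∣ S ∩ B ∣) - p * A S)
        ≡⟨ listSum-distrib-- Ss (λ S → c * (A S * ι ∣ S ∩ B ∣)) (λ S → p * A S) ⟩
      (∑[ S ∈ Ss ] c * (A S * ι ∣ S ∩ B ∣)) - (∑[ S ∈ Ss ] p * A S)
        ≡⟨ cong₂ _-_ (sym (*-distribˡ-listSum Ss c (λ S → A S * ι ∣ S ∩ B ∣))) (sym (*-distribˡ-listSum Ss p A)) ⟩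
      c * (∑[ S ∈ Ss ] A S * ι ∣ S ∩ B ∣) - p * (∑[ S ∈ Ss ] A S)
        ≡⟨ cong₂ (λ x y → c * x - p * y) (transversal-count-meeting f f-parts B) (transversal-count f f-parts) ⟩
      c * (ι ∣ B ∣ * ι m ^ k) - p * (ι m * ι m ^ k)
        ≡⟨ cong (_- p * (ι m * ι m ^ k)) (trans (sym (*-assoc c (ι ∣ B ∣) (ι m ^ k)))
                                                (cong (_* ι m ^ k) (2p/k*n≡p*m {k} {m} {∣ B ∣} p |B|+|B|≡km))) ⟩
      p * ι m * ι m ^ k - p * (ι m * ι m ^ k)
        ≡⟨ solve 3 (λ p m q → p :* m :* q :- p :* (m :* q) := con 0ℚ) refl p (ι m) (ι m ^ k) ⟩
      0ℚ ∎
    where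
      open ≡-Reasoning
      Ss = subsetsOfSize t (suc k)
      A = Aentry t (suc k) f
      c = (((ℤ.+ 2) ℚ./ 1) * p) /ℕ suc k

  -- A function on [t] is determined by its sums over k-subsets

  inWindow : ℕ → ℕ → ℕ → Bool
  inWindow a l n = not (n <ᵇ a) ∧ (n <ᵇ a ℕ.+ l)

  inWindow-below : ∀ a l {n} → n ℕ.< a → inWindow a l n ≡ false
  inWindow-below a l {n} n<a = cong (λ b → not b ∧ (n <ᵇ a ℕ.+ l)) (<⇒<ᵇ≡true n<a)

  inWindow-above : ∀ a l {n} → a ℕ.+ l ℕ.≤ n → inWindow a l n ≡ false
  inWindow-above a l {n} a+l≤n = trans (cong (not (n <ᵇ a) ∧_) (≥⇒<ᵇ≡false a+l≤n)) (∧-zeroʳ (not (n <ᵇ a)))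

  sum-inWindow : ∀ {t} a l → a ℕ.+ l ℕ.≤ t → ∑[ y < t ] 𝟙 (inWindow a l (toℕ y)) ≡ ι l
  sum-inWindow zero l a+l≤t = sum-<ᵇ l a+l≤t
  sum-inWindow {suc t} (suc a) l (s≤s a+l≤t) = trans (+-identityˡ _) (sum-inWindow a l a+l≤t)

  sum-∨-at : ∀ {t} (P : ℕ → Bool) (x : Fin t) (E : Fin t → ℚ) → P (toℕ x) ≡ false →
    ∑[ y < t ] (𝟙 (P (toℕ y) ∨ (toℕ y ≡ᵇ toℕ x)) * E y) ≡ ∑[ y < t ] (𝟙 (P (toℕ y)) * E y) + E x
  sum-∨-at {t} P x E Px≡false = begin
      ∑[ y < t ] (𝟙 (P (toℕ y) ∨ (toℕ y ≡ᵇ toℕ x)) * E y)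
        ≡⟨ sum-cong-≗ (λ y → trans (cong (_* E y) (𝟙-∨ (P (toℕ y)) (toℕ y ≡ᵇ toℕ x) (disjoint y)))
                                   (*-distribʳ-+ (E y) (𝟙 (P (toℕ y))) _)) ⟩
      ∑[ y < t ] (𝟙 (P (toℕ y)) * E y + 𝟙 (toℕ y ≡ᵇ toℕ x) * E y)
        ≡⟨ ∑-distrib-+ (λ y → 𝟙 (P (toℕ y)) * E y) (λ y → 𝟙 (toℕ y ≡ᵇ toℕ x) * E y) ⟩
      ∑[ y < t ] (𝟙 (P (toℕ y)) * E y) + ∑[ y < t ] (𝟙 (toℕ y ≡ᵇ toℕ x) * E y)
        ≡⟨ cong (λ s → ∑[ y < t ] (𝟙 (P (toℕ y)) * E y) + s) (sum-at x E) ⟩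
      ∑[ y < t ] (𝟙 (P (toℕ y)) * E y) + E x ∎
    where
      open ≡-Reasoning
      disjoint : ∀ y → (toℕ y ≡ᵇ toℕ x) ≡ true → P (toℕ y) ≡ false
      disjoint y y≡x = trans (cong P (ℕₚ.≡ᵇ⇒≡ (toℕ y) (toℕ x) (subst T (sym y≡x) tt))) Px≡false
      𝟙-∨ : ∀ a b → (b ≡ true → a ≡ false) → 𝟙 (a ∨ b) ≡ 𝟙 a + 𝟙 b
      𝟙-∨ true true b⇒¬a with b⇒¬a refl
      ... | ()
      𝟙-∨ true false _ = sym (+-identityʳ 1ℚ)
      𝟙-∨ false true _ = sym (+-identityˡ 1ℚ)
      𝟙-∨ false false _ = sym (+-identityʳ 0ℚ)

  -- Adding x to a window W of k points gives E x = − Σ_W E.  Each point misses one of the windows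
  -- [0, k) and [k, 2k), and the point 2k misses both, so E is the constant −Σ_{[0,k)} E, which is
  -- then k times its own negative.
  module _ {t k} (E : Fin t → ℚ) (2k+1≤t : suc (k ℕ.+ k) ℕ.≤ t)
           (sums≡0 : ∀ S → ∣ S ∣ ≡ suc k → ∑[ x < t ] (𝟙 (lookup S x) * E x) ≡ 0ℚ) where

    private
      windowSum : ℕ → ℚ
      windowSum a = ∑[ y < t ] (𝟙 (inWindow a k (toℕ y)) * E y)

      E≡-windowSum : ∀ a x → inWindow a k (toℕ x) ≡ false → a ℕ.+ k ℕ.≤ t → E x ≡ - windowSum a
      E≡-windowSum a x x∉window a+k≤t = begin
          E x                                                 ≡⟨ solve 2 (λ w e → e := (w :+ e) :- w) refl (windowSum a) (E x) ⟩
          (windowSum a + E x) - windowSum a                   ≡⟨ cong (_- windowSum a) (sym (sum-S E)) ⟩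
          (∑[ y < t ] (𝟙 (lookup S y) * E y)) - windowSum a   ≡⟨ cong (_- windowSum a) (sums≡0 S |S|≡1+k) ⟩
          0ℚ - windowSum a                                    ≡⟨ +-identityˡ (- windowSum a) ⟩
          - windowSum a                                       ∎
        where
          open ≡-Reasoning
          P = inWindow a k
          S : Subset t
          S = tabulate (λ y → P (toℕ y) ∨ (toℕ y ≡ᵇ toℕ x))
          sum-S : ∀ g → ∑[ y < t ] (𝟙 (lookup S y) * g y) ≡ ∑[ y < t ] (𝟙 (P (toℕ y)) * g y) + g x
          sum-S g = trans (sum-cong-≗ (λ y → cong (λ b → 𝟙 b * g y) (lookup∘tabulate (λ y → P (toℕ y) ∨ (toℕ y ≡ᵇ toℕ x)) y)))
                          (sum-∨-at P x g x∉window)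
          |S|≡1+k : ∣ S ∣ ≡ suc k
          |S|≡1+k = ι-injective (begin
              ι ∣ S ∣                               ≡⟨ ι-size S ⟩
              ∑[ y < t ] 𝟙 (lookup S y)             ≡⟨ sum-cong-≗ {t} (λ y → sym (*-identityʳ (𝟙 (lookup S y)))) ⟩
              ∑[ y < t ] (𝟙 (lookup S y) * 1ℚ)      ≡⟨ sum-S (λ _ → 1ℚ) ⟩
              ∑[ y < t ] (𝟙 (P (toℕ y)) * 1ℚ) + 1ℚ  ≡⟨ cong (_+ 1ℚ) (sum-cong-≗ {t} (λ y → *-identityʳ (𝟙 (P (toℕ y))))) ⟩
              ∑[ y < t ] 𝟙 (P (toℕ y)) + 1ℚ         ≡⟨ cong (_+ 1ℚ) (sum-inWindow a k a+k≤t) ⟩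
              ι k + 1ℚ                              ≡⟨ +-comm (ι k) 1ℚ ⟩
              ι (suc k)                             ∎)

      z : Fin t
      z = fromℕ< 2k+1≤t

      k≤k+k : k ℕ.≤ k ℕ.+ k
      k≤k+k = ℕₚ.m≤m+n k k

      k+k≤z : k ℕ.+ k ℕ.≤ toℕ z
      k+k≤z = ℕₚ.≤-reflexive (sym (toℕ-fromℕ< 2k+1≤t))

      k+k≤t : k ℕ.+ k ℕ.≤ t
      k+k≤t = ℕₚ.<⇒≤ 2k+1≤t

      k≤t : k ℕ.≤ t
      k≤t = ℕₚ.≤-trans k≤k+k k+k≤t

      E≡-windowSum₀ : ∀ x → E x ≡ - windowSum 0
      E≡-windowSum₀ x with toℕ x ℕ.<? k
      ... | no x≮k = E≡-windowSum 0 x (inWindow-above 0 k (ℕₚ.≮⇒≥ x≮k)) k≤t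
      ... | yes x<k = begin
          E x            ≡⟨ E≡-windowSum k x (inWindow-below k k x<k) k+k≤t ⟩
          - windowSum k  ≡⟨ sym (E≡-windowSum k z (inWindow-above k k k+k≤z) k+k≤t) ⟩
          E z            ≡⟨ E≡-windowSum 0 z (inWindow-above 0 k (ℕₚ.≤-trans k≤k+k k+k≤z)) k≤t ⟩
          - windowSum 0  ∎
        where open ≡-Reasoning

      windowSum₀≡0 : windowSum 0 ≡ 0ℚ
      windowSum₀≡0 = p≢0⇒p*q≡0⇒q≡0 (ι[1+n]≢0 k) (begin
          ι (suc k) * w                                 ≡⟨ solve 2 (λ n w → (con 1ℚ :+ n) :* w := w :- n :* (:- w)) refl (ι k) w ⟩
          w - ι k * (- w)                               ≡⟨ cong (λ s → w - s * (- w)) (sym (sum-inWindow 0 k k≤t)) ⟩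
          w - (∑[ y < t ] 𝟙 (inWindow 0 k (toℕ y))) * (- w)
                                                        ≡⟨ cong (λ s → w - s) (*-distribʳ-sum {t} (- w) (λ y → 𝟙 (inWindow 0 k (toℕ y)))) ⟩
          w - ∑[ y < t ] (𝟙 (inWindow 0 k (toℕ y)) * (- w))
                                                        ≡⟨ cong (λ s → w - s) (sum-cong-≗ {t} (λ y → cong (𝟙 (inWindow 0 k (toℕ y)) *_)
                                                                                                  (sym (E≡-windowSum₀ y)))) ⟩
          w - w                                         ≡⟨ +-inverseʳ w ⟩
          0ℚ                                            ∎)
        where
          open ≡-Reasoning
          w = windowSum 0

    subset-sums≡0⇒≡0 : ∀ x → E x ≡ 0ℚ
    subset-sums≡0⇒≡0 x = trans (E≡-windowSum₀ x) (cong -_ windowSum₀≡0)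

  -- The t affinely independent vectors

  𝟙-swap : ∀ h a b n → a ℕ.< h → h ℕ.≤ b →
    𝟙 (((n <ᵇ h) ∧ not (n ≡ᵇ a)) ∨ (n ≡ᵇ b)) ≡ 𝟙 (n <ᵇ h) - 𝟙 (n ≡ᵇ a) + 𝟙 (n ≡ᵇ b)
  𝟙-swap h a b n a<h h≤b with n ℕ.≟ b
  ... | yes refl rewrite ≡ᵇ-refl n | ≥⇒<ᵇ≡false h≤b | ≢⇒≡ᵇ≡false (ℕₚ.<⇒≢ (ℕₚ.<-≤-trans a<h h≤b) ∘ sym) =
    solve 0 (con 1ℚ := con 0ℚ :- con 0ℚ :+ con 1ℚ) refl
  ... | no n≢b rewrite ≢⇒≡ᵇ≡false n≢b with n ℕ.≟ a
  ...   | yes refl rewrite ≡ᵇ-refl n | <⇒<ᵇ≡true a<h = solve 0 (con 0ℚ := con 1ℚ :- con 1ℚ :+ con 0ℚ) refl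
  ...   | no n≢a rewrite ≢⇒≡ᵇ≡false n≢a | ∧-identityʳ (n <ᵇ h) | ∨-identityʳ (n <ᵇ h) =
    solve 1 (λ u → u := u :- con 0ℚ :+ con 0ℚ) refl (𝟙 (n <ᵇ h))

  module Construction (l : ℕ) where

    h : ℕ
    h = suc l

    t : ℕ
    t = suc (suc (l ℕ.+ l))

    h+h≡t : h ℕ.+ h ≡ t
    h+h≡t = cong suc (ℕₚ.+-suc l l)

    h<t : h ℕ.< t
    h<t = s≤s (s≤s (ℕₚ.m≤m+n l l))

    Swap : Set
    Swap = Fin l ⊎ Fin l

    leaving : Swap → ℕ
    leaving (inj₁ i) = 0
    leaving (inj₂ i) = suc (toℕ i)

    entering : Swap → ℕ
    entering (inj₁ i) = suc (h ℕ.+ toℕ i)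
    entering (inj₂ i) = h

    leaving<h : ∀ s → leaving s ℕ.< h
    leaving<h (inj₁ i) = s≤s z≤n
    leaving<h (inj₂ i) = s≤s (toℕ<n i)

    h≤entering : ∀ s → h ℕ.≤ entering s
    h≤entering (inj₁ i) = ℕₚ.m≤n⇒m≤1+n (ℕₚ.m≤m+n h (toℕ i))
    h≤entering (inj₂ i) = ℕₚ.≤-refl

    entering<t : ∀ s → entering s ℕ.< t
    entering<t (inj₁ i) = s≤s (s≤s (subst (ℕ._≤ l ℕ.+ l) (ℕₚ.+-suc l (toℕ i)) (ℕₚ.+-monoʳ-≤ l (toℕ<n i))))
    entering<t (inj₂ i) = h<t

    inLower : ℕ → Bool
    inLower n = n <ᵇ h

    inSwapped : Swap → ℕ → Bool
    inSwapped s n = (inLower n ∧ not (n ≡ᵇ leaving s)) ∨ (n ≡ᵇ entering s)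

    lower : Subset t
    lower = tabulate (inLower ∘ toℕ)

    swapped : Swap → Subset t
    swapped s = tabulate (inSwapped s ∘ toℕ)

    |lower|≡h : ∣ lower ∣ ≡ h
    |lower|≡h = ι-injective (trans (ι-size-tabulate t inLower) (sum-<ᵇ h (ℕₚ.<⇒≤ h<t)))

    |swapped|≡h : ∀ s → ∣ swapped s ∣ ≡ h
    |swapped|≡h s = ι-injective (begin
        ι ∣ swapped s ∣
          ≡⟨ ι-size-tabulate t (inSwapped s) ⟩
        ∑[ y < t ] 𝟙 (inSwapped s (toℕ y))
          ≡⟨ sum-cong-≗ {t} (λ y → 𝟙-swap h (leaving s) (entering s) (toℕ y) (leaving<h s) (h≤entering s)) ⟩
        ∑[ y < t ] (𝟙 (inLower (toℕ y)) - 𝟙 (toℕ y ≡ᵇ leaving s) + 𝟙 (toℕ y ≡ᵇ entering s))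
          ≡⟨ ∑-distrib-+ {t} (λ y → 𝟙 (inLower (toℕ y)) - 𝟙 (toℕ y ≡ᵇ leaving s)) (λ y → 𝟙 (toℕ y ≡ᵇ entering s)) ⟩
        ∑[ y < t ] (𝟙 (inLower (toℕ y)) - 𝟙 (toℕ y ≡ᵇ leaving s)) + ∑[ y < t ] 𝟙 (toℕ y ≡ᵇ entering s)
          ≡⟨ cong (_+ ∑[ y < t ] 𝟙 (toℕ y ≡ᵇ entering s))
                  (∑-distrib-- {t} (λ y → 𝟙 (inLower (toℕ y))) (λ y → 𝟙 (toℕ y ≡ᵇ leaving s))) ⟩
        ∑[ y < t ] 𝟙 (inLower (toℕ y)) - ∑[ y < t ] 𝟙 (toℕ y ≡ᵇ leaving s) + ∑[ y < t ] 𝟙 (toℕ y ≡ᵇ entering s)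
          ≡⟨ cong₂ _+_ (cong₂ _-_ (sum-<ᵇ h (ℕₚ.<⇒≤ h<t)) (sum-≡ᵇ (leaving s) (ℕₚ.<-trans (leaving<h s) h<t)))
                       (sum-≡ᵇ (entering s) (entering<t s)) ⟩
        ι h - 1ℚ + 1ℚ
          ≡⟨ solve 1 (λ x → x :- con 1ℚ :+ con 1ℚ := x) refl (ι h) ⟩
        ι h ∎)
      where open ≡-Reasoning

    edge : ℕ → Swap → ℚ
    edge n s = 𝟙 (n ≡ᵇ leaving s) - 𝟙 (n ≡ᵇ entering s)

    edgeSum : (Swap → ℚ) → ℕ → ℚ
    edgeSum d n = ∑[ i < l ] (d (inj₁ i) * edge n (inj₁ i)) + ∑[ i < l ] (d (inj₂ i) * edge n (inj₂ i))

    private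
      vanishing-edge : ∀ (d : Swap → ℚ) s n → n ≢ leaving s → n ≢ entering s → d s * edge n s ≡ 0ℚ
      vanishing-edge d s n n≢a n≢b rewrite ≢⇒≡ᵇ≡false n≢a | ≢⇒≡ᵇ≡false n≢b =
        trans (cong (d s *_) (+-inverseʳ 0ℚ)) (*-zeroʳ (d s))

      leaving≢entering : ∀ s → leaving s ≢ entering s
      leaving≢entering s = ℕₚ.<⇒≢ (ℕₚ.<-≤-trans (leaving<h s) (h≤entering s))

      edge-leaving : ∀ (d : Swap → ℚ) s → d s * edge (leaving s) s ≡ d s
      edge-leaving d s rewrite ≡ᵇ-refl (leaving s) | ≢⇒≡ᵇ≡false (leaving≢entering s) =
        trans (cong (d s *_) (+-identityʳ 1ℚ)) (*-identityʳ (d s))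

      edge-entering : ∀ (d : Swap → ℚ) s → d s * edge (entering s) s ≡ - d s
      edge-entering d s rewrite ≡ᵇ-refl (entering s) | ≢⇒≡ᵇ≡false (leaving≢entering s ∘ sym) =
        solve 1 (λ d → d :* (con 0ℚ :- con 1ℚ) := :- d) refl (d s)

      i<h+i′ : ∀ (i i′ : Fin l) → toℕ i ℕ.< h ℕ.+ toℕ i′
      i<h+i′ i i′ = ℕₚ.≤-trans (toℕ<n i) (ℕₚ.m≤n⇒m≤1+n (ℕₚ.m≤m+n l (toℕ i′)))

    edgeSum-entering : ∀ (d : Swap → ℚ) i → edgeSum d (entering (inj₁ i)) ≡ - d (inj₁ i)
    edgeSum-entering d i = trans (cong₂ _+_
        (sum-single (λ i′ → d (inj₁ i′) * edge n (inj₁ i′)) i (λ i′ i′≢i → vanishing-edge d (inj₁ i′) n (λ ())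
           (i′≢i ∘ toℕ-injective ∘ ℕₚ.+-cancelˡ-≡ h _ _ ∘ ℕₚ.suc-injective ∘ sym)))
        (sum-zeros (λ i′ → vanishing-edge d (inj₂ i′) n (ℕₚ.<⇒≢ (s≤s (i<h+i′ i′ i)) ∘ sym)
           (ℕₚ.<⇒≢ (s≤s (ℕₚ.m≤m+n h (toℕ i))) ∘ sym))))
      (trans (+-identityʳ _) (edge-entering d (inj₁ i)))
      where n = entering (inj₁ i)

    edgeSum-leaving : ∀ (d : Swap → ℚ) i → edgeSum d (leaving (inj₂ i)) ≡ d (inj₂ i)
    edgeSum-leaving d i = trans (cong₂ _+_
        (sum-zeros (λ i′ → vanishing-edge d (inj₁ i′) n (λ ()) (ℕₚ.<⇒≢ (s≤s (i<h+i′ i i′)))))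
        (sum-single (λ i′ → d (inj₂ i′) * edge n (inj₂ i′)) i (λ i′ i′≢i → vanishing-edge d (inj₂ i′) n
           (i′≢i ∘ toℕ-injective ∘ ℕₚ.suc-injective ∘ sym) (ℕₚ.<⇒≢ (s≤s (toℕ<n i)) ∘ sym ∘ sym))))
      (trans (+-identityˡ _) (edge-leaving d (inj₂ i)))
      where n = leaving (inj₂ i)

    edgeSum-0 : ∀ (d : Swap → ℚ) → edgeSum d 0 ≡ ∑[ i < l ] d (inj₁ i)
    edgeSum-0 d = trans (cong₂ _+_ (sum-cong-≗ (λ i → trans (cong (d (inj₁ i) *_) (+-identityʳ 1ℚ)) (*-identityʳ _)))
                                   (sum-zeros (λ i → trans (cong (d (inj₂ i) *_) (+-inverseʳ 0ℚ)) (*-zeroʳ (d (inj₂ i))))))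
                        (+-identityʳ _)

    edgeForm : ℚ → (Swap → ℚ) → ℕ → ℚ
    edgeForm c₀ d n = c₀ * (ι 2 * 𝟙 (inLower n) - 1ℚ) + ι 2 * edgeSum d n

    edges-independent : 1 ℕ.< l → ∀ c₀ (d : Swap → ℚ) → (∀ n → n ℕ.< t → edgeForm c₀ d n ≡ 0ℚ) →
      c₀ ≡ 0ℚ × (∀ s → d s ≡ 0ℚ)
    edges-independent 1<l c₀ d D≡0 = c₀≡0 , d≡0
      where
        2d≡-c₀ : ∀ s → ι 2 * d s ≡ - c₀
        2d≡-c₀ (inj₁ i) = begin
            ι 2 * d (inj₁ i)
              ≡⟨ solve 2 (λ c e → con (ι 2) :* e
                          := :- c :- (c :* (con (ι 2) :* con 0ℚ :- con 1ℚ) :+ con (ι 2) :* (:- e)))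
                   refl c₀ (d (inj₁ i)) ⟩
            - c₀ - (c₀ * (ι 2 * 0ℚ - 1ℚ) + ι 2 * - d (inj₁ i))
              ≡⟨ cong (λ z → - c₀ - z) (trans (cong₂ (λ b e → c₀ * (ι 2 * 𝟙 b - 1ℚ) + ι 2 * e)
                                                  (sym (≥⇒<ᵇ≡false (h≤entering (inj₁ i)))) (sym (edgeSum-entering d i)))
                                           (D≡0 (entering (inj₁ i)) (entering<t (inj₁ i)))) ⟩
            - c₀ - 0ℚ
              ≡⟨ +-identityʳ (- c₀) ⟩
            - c₀ ∎
          where open ≡-Reasoning
        2d≡-c₀ (inj₂ i) = begin
            ι 2 * d (inj₂ i)
              ≡⟨ solve 2 (λ c e → con (ι 2) :* e
                          := :- c :+ (c :* (con (ι 2) :* con 1ℚ :- con 1ℚ) :+ con (ι 2) :* e))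
                   refl c₀ (d (inj₂ i)) ⟩
            - c₀ + (c₀ * (ι 2 * 1ℚ - 1ℚ) + ι 2 * d (inj₂ i))
              ≡⟨ cong (λ z → - c₀ + z) (trans (cong₂ (λ b e → c₀ * (ι 2 * 𝟙 b - 1ℚ) + ι 2 * e)
                                                  (sym (<⇒<ᵇ≡true (leaving<h (inj₂ i)))) (sym (edgeSum-leaving d i)))
                                           (D≡0 (leaving (inj₂ i)) (ℕₚ.<-trans (leaving<h (inj₂ i)) h<t))) ⟩
            - c₀ + 0ℚ
              ≡⟨ +-identityʳ (- c₀) ⟩
            - c₀ ∎
          where open ≡-Reasoning

        ι[l]-1≢0 : ι l - 1ℚ ≢ 0ℚ
        ι[l]-1≢0 ι[l]-1≡0 = ℕₚ.<⇒≢ 1<l (sym (ι-injective (begin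
            ι l                   ≡⟨ solve 1 (λ x → x := (x :- con 1ℚ) :+ con 1ℚ) refl (ι l) ⟩
            (ι l - 1ℚ) + 1ℚ       ≡⟨ cong (_+ 1ℚ) ι[l]-1≡0 ⟩
            0ℚ + 1ℚ               ≡⟨ +-identityˡ 1ℚ ⟩
            ι 1                   ∎)))
          where open ≡-Reasoning

        c₀≡0 : c₀ ≡ 0ℚ
        c₀≡0 = p≢0⇒p*q≡0⇒q≡0 ι[l]-1≢0 (begin
            (ι l - 1ℚ) * c₀
              ≡⟨ solve 2 (λ c m → (m :- con 1ℚ) :* c := :- (c :* (con (ι 2) :* con 1ℚ :- con 1ℚ) :+ m :* (:- c)))
                       refl c₀ (ι l) ⟩
            - (c₀ * (ι 2 * 1ℚ - 1ℚ) + ι l * - c₀)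
              ≡⟨ cong (λ z → - (c₀ * (ι 2 * 1ℚ - 1ℚ) + z)) (begin
                   ι l * - c₀                     ≡⟨ sym (sum-const l (- c₀)) ⟩
                   ∑[ i < l ] (- c₀)              ≡⟨ sum-cong-≗ (λ i → sym (2d≡-c₀ (inj₁ i))) ⟩
                   ∑[ i < l ] (ι 2 * d (inj₁ i))  ≡⟨ sym (*-distribˡ-sum (ι 2) (d ∘ inj₁)) ⟩
                   ι 2 * ∑[ i < l ] d (inj₁ i)    ≡⟨ cong (ι 2 *_) (sym (edgeSum-0 d)) ⟩
                   ι 2 * edgeSum d 0              ∎) ⟩
            - (c₀ * (ι 2 * 1ℚ - 1ℚ) + ι 2 * edgeSum d 0)
              ≡⟨ cong -_ (D≡0 0 (s≤s z≤n)) ⟩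
            - 0ℚ
              ≡⟨⟩
            0ℚ ∎)
          where open ≡-Reasoning

        d≡0 : ∀ s → d s ≡ 0ℚ
        d≡0 s = p≢0⇒p*q≡0⇒q≡0 (ι[1+n]≢0 1) (trans (2d≡-c₀ s) (cong -_ c₀≡0))

    t/2≡h : t ℕ./ 2 ≡ h
    t/2≡h = trans (cong (ℕ._/ 2) t≡h*2) (m*n/n≡m h 2)
      where t≡h*2 : t ≡ h ℕ.* 2
            t≡h*2 = cong (λ n → suc (suc n)) (trans (cong (l ℕ.+_) (sym (ℕₚ.+-identityʳ l))) (ℕₚ.*-comm 2 l))

    double-h : ∀ {n} (C : Subset t) → ∣ C ∣ ≡ h → n ≡ t → ∣ C ∣ ℕ.+ ∣ C ∣ ≡ n
    double-h C |C|≡h n≡t = trans (cong₂ ℕ._+_ |C|≡h |C|≡h) (trans h+h≡t (sym n≡t))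

    swap : Fin (l ℕ.+ l) → Swap
    swap = splitAt l

    sum-swap : ∀ (g : Swap → ℚ) → ∑[ j < l ℕ.+ l ] g (swap j) ≡ ∑[ i < l ] g (inj₁ i) + ∑[ i < l ] g (inj₂ i)
    sum-swap g = trans (sum-↑ l (g ∘ swap)) (cong₂ _+_ (sum-cong-≗ (λ i → cong g (splitAt-↑ˡ l i l)))
                                                       (sum-cong-≗ (λ i → cong g (splitAt-↑ʳ l l i))))

    module Vectors (k : ℕ) (p : ℚ) where

      members : Fin t → Member t
      members zero = vMem lower (trans |lower|≡h (sym t/2≡h))
      members (suc zero) = uMem
      members (suc (suc j)) = vMem (swapped (swap j)) (trans (|swapped|≡h (swap j)) (sym t/2≡h))

      difference : Fin (suc (l ℕ.+ l)) → Subset t → ℚ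
      difference j S = memberVec t (suc k) p (members zero) S - memberVec t (suc k) p (members (suc j)) S

      private
        q c : ℚ
        q = p * ((ℤ.+ 1) ℚ./ suc k)
        c = (((ℤ.+ 2) ℚ./ 1) * p) /ℕ suc k

        c≡2q : c ≡ ι 2 * q
        c≡2q = trans (cong (λ two → two * p * ((ℤ.+ 1) ℚ./ suc k)) ([+n]/1≡ι 2)) (*-assoc (ι 2) p _)

        q≢0 : p ≢ 0ℚ → q ≢ 0ℚ
        q≢0 p≢0 q≡0 with p*q≡0⇒p≡0⊎q≡0 q≡0
        ... | inj₁ p≡0 = p≢0 p≡0
        ... | inj₂ 1/k≡0 = 1≢0 (trans (sym ([1/n]*ι[n]≡1 k)) (trans (cong (_* ι (suc k)) 1/k≡0) (*-zeroˡ (ι (suc k)))))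

        vVec≡sum : ∀ B S → vVec t (suc k) p B S ≡ ∑[ y < t ] (𝟙 (lookup S y) * (c * 𝟙 (lookup B y)))
        vVec≡sum B S = trans (cong (c *_) (trans ([+n]/1≡ι ∣ S ∩ B ∣) (ι-size-∩ S B)))
          (trans (*-distribˡ-sum c (λ y → 𝟙 (lookup S y) * 𝟙 (lookup B y)))
                 (sum-cong-≗ (λ y → solve 3 (λ c s b → c :* (s :* b) := s :* (c :* b)) refl
                                            c (𝟙 (lookup S y)) (𝟙 (lookup B y)))))

        uVec≡sum : ∀ S → ∣ S ∣ ≡ suc k → uVec t p (suc k) S ≡ ∑[ y < t ] (𝟙 (lookup S y) * q)
        uVec≡sum S |S|≡k = begin
            p                                   ≡⟨ sym (*-identityʳ p) ⟩
            p * 1ℚ                              ≡⟨ cong (p *_) (sym ([1/n]*ι[n]≡1 k)) ⟩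
            p * (1/k * ι (suc k))               ≡⟨ solve 3 (λ p i n → p :* (i :* n) := n :* (p :* i)) refl p 1/k (ι (suc k)) ⟩
            ι (suc k) * q                       ≡⟨ cong (λ n → ι n * q) (sym |S|≡k) ⟩
            ι ∣ S ∣ * q                         ≡⟨ cong (_* q) (ι-size S) ⟩
            (∑[ y < t ] 𝟙 (lookup S y)) * q     ≡⟨ *-distribʳ-sum q (λ y → 𝟙 (lookup S y)) ⟩
            ∑[ y < t ] (𝟙 (lookup S y) * q)     ∎
          where
            open ≡-Reasoning
            1/k = (ℤ.+ 1) ℚ./ suc k

      density : Fin (suc (l ℕ.+ l)) → Fin t → ℚ
      density zero y = c * 𝟙 (lookup lower y) - q
      density (suc j) y = c * 𝟙 (lookup lower y) - c * 𝟙 (lookup (swapped (swap j)) y)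

      difference≡sum-density : ∀ j S → ∣ S ∣ ≡ suc k → difference j S ≡ ∑[ y < t ] (𝟙 (lookup S y) * density j y)
      difference≡sum-density zero S |S|≡k = trans (cong₂ _-_ (vVec≡sum lower S) (uVec≡sum S |S|≡k))
        (trans (sym (∑-distrib-- (λ y → 𝟙 (lookup S y) * (c * 𝟙 (lookup lower y))) (λ y → 𝟙 (lookup S y) * q)))
               (sum-cong-≗ (λ y → sym (*-distribˡ-minus (𝟙 (lookup S y)) (c * 𝟙 (lookup lower y)) q))))
      difference≡sum-density (suc j) S _ = trans (cong₂ _-_ (vVec≡sum lower S) (vVec≡sum (swapped (swap j)) S))
        (trans (sym (∑-distrib-- (λ y → 𝟙 (lookup S y) * (c * 𝟙 (lookup lower y)))
                                 (λ y → 𝟙 (lookup S y) * (c * 𝟙 (lookup (swapped (swap j)) y)))))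
               (sum-cong-≗ (λ y → sym (*-distribˡ-minus (𝟙 (lookup S y)) (c * 𝟙 (lookup lower y))
                                                                        (c * 𝟙 (lookup (swapped (swap j)) y))))))

      private
        density-zero : ∀ y → density zero y ≡ q * (ι 2 * 𝟙 (inLower (toℕ y)) - 1ℚ)
        density-zero y = trans (cong₂ (λ a b → a * 𝟙 b - q) c≡2q (lookup∘tabulate (inLower ∘ toℕ) y))
          (solve 2 (λ q e → con (ι 2) :* q :* e :- q := q :* (con (ι 2) :* e :- con 1ℚ))
                 refl q (𝟙 (inLower (toℕ y))))

        density-suc : ∀ j y → density (suc j) y ≡ q * (ι 2 * edge (toℕ y) (swap j))
        density-suc j y = begin
            c * 𝟙 (lookup lower y) - c * 𝟙 (lookup (swapped s) y)
              ≡⟨ cong₂ (λ a b → c * 𝟙 a - c * 𝟙 b) (lookup∘tabulate (inLower ∘ toℕ) y) (lookup∘tabulate (inSwapped s ∘ toℕ) y) ⟩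
            c * 𝟙 (inLower n) - c * 𝟙 (inSwapped s n)
              ≡⟨ cong₂ (λ a b → a * 𝟙 (inLower n) - a * b) c≡2q (𝟙-swap h (leaving s) (entering s) n (leaving<h s) (h≤entering s)) ⟩
            ι 2 * q * 𝟙 (inLower n) - ι 2 * q * (𝟙 (inLower n) - 𝟙 (n ≡ᵇ leaving s) + 𝟙 (n ≡ᵇ entering s))
              ≡⟨ solve 4 (λ q u a b → con (ι 2) :* q :* u :- con (ι 2) :* q :* (u :- a :+ b)
                                 := q :* (con (ι 2) :* (a :- b)))
                   refl q (𝟙 (inLower n)) (𝟙 (n ≡ᵇ leaving s)) (𝟙 (n ≡ᵇ entering s)) ⟩
            q * (ι 2 * edge n s) ∎
          where
            open ≡-Reasoning
            s = swap j
            n = toℕ y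

      combination≡edgeForm : ∀ (a : Fin (suc (l ℕ.+ l)) → ℚ) y →
        ∑[ j < suc (l ℕ.+ l) ] (a j * density j y) ≡ q * edgeForm (a zero) (a ∘ suc ∘ join l l) (toℕ y)
      combination≡edgeForm a y = begin
          a zero * density zero y + ∑[ j < l ℕ.+ l ] (a (suc j) * density (suc j) y)
            ≡⟨ cong₂ _+_ (cong (a zero *_) (density-zero y))
                 (sum-cong-≗ (λ j → trans (cong (a (suc j) *_) (density-suc j y))
                   (solve 3 (λ a q e → a :* (q :* (con (ι 2) :* e)) := q :* con (ι 2) :* (a :* e))
                          refl (a (suc j)) q (edge n (swap j))))) ⟩
          a zero * (q * X) + ∑[ j < l ℕ.+ l ] (q * ι 2 * (a (suc j) * edge n (swap j)))
            ≡⟨ cong (λ z → a zero * (q * X) + z) (sym (*-distribˡ-sum (q * ι 2) (λ j → a (suc j) * edge n (swap j)))) ⟩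
          a zero * (q * X) + q * ι 2 * ∑[ j < l ℕ.+ l ] (a (suc j) * edge n (swap j))
            ≡⟨ cong (λ z → a zero * (q * X) + q * ι 2 * z)
                 (trans (sum-cong-≗ (λ j → cong (λ i → a (suc i) * edge n (swap j)) (sym (join-splitAt l l j))))
                        (sum-swap (λ s → d s * edge n s))) ⟩
          a zero * (q * X) + q * ι 2 * edgeSum d n
            ≡⟨ solve 4 (λ a q x e → a :* (q :* x) :+ q :* con (ι 2) :* e
                               := q :* (a :* x :+ con (ι 2) :* e)) refl (a zero) q X (edgeSum d n) ⟩
          q * (a zero * X + ι 2 * edgeSum d n) ∎
        where
          open ≡-Reasoning
          n = toℕ y
          X = ι 2 * 𝟙 (inLower n) - 1ℚ
          d = a ∘ suc ∘ join l l

      differences-independent : p ≢ 0ℚ → suc (k ℕ.+ k) ℕ.≤ t → 1 ℕ.< l →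
        AffIndep t (suc k) t (λ i → memberVec t (suc k) p (members i))
      differences-independent p≢0 2k+1≤t 1<l a dependency j = a≡0 j
        where
          E : Fin t → ℚ
          E y = ∑[ j < suc (l ℕ.+ l) ] (a j * density j y)

          E-sums≡0 : ∀ S → ∣ S ∣ ≡ suc k → ∑[ y < t ] (𝟙 (lookup S y) * E y) ≡ 0ℚ
          E-sums≡0 S |S|≡k = begin
              ∑[ y < t ] (𝟙 (lookup S y) * E y)
                ≡⟨ sum-cong-≗ (λ y → trans (*-distribˡ-sum (𝟙 (lookup S y)) (λ j → a j * density j y))
                     (sum-cong-≗ (λ j → solve 3 (λ s a e → s :* (a :* e) := a :* (s :* e)) refl (𝟙 (lookup S y)) (a j) (density j y)))) ⟩
              ∑[ y < t ] ∑[ j < suc (l ℕ.+ l) ] (a j * (𝟙 (lookup S y) * density j y))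
                ≡⟨ ∑-comm (λ y j → a j * (𝟙 (lookup S y) * density j y)) ⟩
              ∑[ j < suc (l ℕ.+ l) ] ∑[ y < t ] (a j * (𝟙 (lookup S y) * density j y))
                ≡⟨ sum-cong-≗ (λ j → trans (sym (*-distribˡ-sum (a j) (λ y → 𝟙 (lookup S y) * density j y)))
                                           (cong (a j *_) (sym (difference≡sum-density j S |S|≡k)))) ⟩
              ∑[ j < suc (l ℕ.+ l) ] (a j * difference j S)
                ≡⟨ sym (Σℚ≡sum (suc (l ℕ.+ l)) (λ j → a j * difference j S)) ⟩
              Σℚ (suc (l ℕ.+ l)) (λ j → a j * difference j S)
                ≡⟨ dependency S |S|≡k ⟩
              0ℚ ∎
            where open ≡-Reasoning

          edgeForm≡0 : ∀ n → n ℕ.< t → edgeForm (a zero) (a ∘ suc ∘ join l l) n ≡ 0ℚ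
          edgeForm≡0 n n<t = subst (λ m → edgeForm (a zero) (a ∘ suc ∘ join l l) m ≡ 0ℚ) (toℕ-fromℕ< n<t)
            (p≢0⇒p*q≡0⇒q≡0 (q≢0 p≢0) (trans (sym (combination≡edgeForm a y)) (subset-sums≡0⇒≡0 E 2k+1≤t E-sums≡0 y)))
            where y = fromℕ< n<t

          a≡0 : ∀ j → a j ≡ 0ℚ
          a≡0 zero = proj₁ (edges-independent 1<l (a zero) (a ∘ suc ∘ join l l) edgeForm≡0)
          a≡0 (suc j) = trans (cong (a ∘ suc) (sym (join-splitAt l l j)))
                              (proj₂ (edges-independent 1<l (a zero) (a ∘ suc ∘ join l l) edgeForm≡0) (swap j))

      differences-orthogonal : ∀ {m} (f : Fin t → Fin (suc k)) → IsOrdPart (λ _ → m) f → suc k ℕ.* m ≡ t →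
        ∀ j → ∑[ S ∈ subsetsOfSize t (suc k) ] Aentry t (suc k) f S * difference j S ≡ 0ℚ
      differences-orthogonal f f-parts km≡t zero = row-orthogonal f f-parts p lower (double-h lower |lower|≡h km≡t)
      differences-orthogonal f f-parts km≡t (suc j) = begin
          ∑[ S ∈ Ss ] A S * (v lower S - v B S)
            ≡⟨ listSum-cong-≗ Ss (λ S → solve 4 (λ a x y u → a :* (x :- y) := a :* (x :- u) :- a :* (y :- u)) refl
                                          (A S) (v lower S) (v B S) (uVec t p (suc k) S)) ⟩
          ∑[ S ∈ Ss ] (A S * (v lower S - u S) - A S * (v B S - u S))
            ≡⟨ listSum-distrib-- Ss (λ S → A S * (v lower S - u S)) (λ S → A S * (v B S - u S)) ⟩
          (∑[ S ∈ Ss ] A S * (v lower S - u S)) - (∑[ S ∈ Ss ] A S * (v B S - u S))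
            ≡⟨ cong₂ _-_ (row-orthogonal f f-parts p lower (double-h lower |lower|≡h km≡t))
                         (row-orthogonal f f-parts p B (double-h B (|swapped|≡h (swap j)) km≡t)) ⟩
          0ℚ - 0ℚ
            ≡⟨ +-inverseʳ 0ℚ ⟩
          0ℚ ∎
        where
          open ≡-Reasoning
          Ss = subsetsOfSize t (suc k)
          A = Aentry t (suc k) f
          B = swapped (swap j)
          v = vVec t (suc k) p
          u = uVec t p (suc k)

    rank-bound : ∀ k → suc (k ℕ.+ k) ℕ.≤ t → 1 ℕ.< l → suc k ∣ t →
      RankAtMost t (suc k) (λ _ → t div suc k) ((t C suc k) ℕ.∸ t ℕ.+ 1)
    rank-bound k 2k+1≤t 1<l k∣t rows rows-parts = e , e≢0 , λ S |S|≡k →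
        trans (Σℚ≡sum _ (λ i → e i * Aentry t (suc k) (rows i) S)) (vanish (size⇒∈subsetsOfSize S |S|≡k))
      where
        open Vectors k 1ℚ
        Ss = subsetsOfSize t (suc k)

        independent-differences : Independent Ss (suc (l ℕ.+ l)) difference
        independent-differences a vanish = differences-independent 1≢0 2k+1≤t 1<l a
          (λ S |S|≡k → trans (Σℚ≡sum _ (λ i → a i * difference i S)) (vanish (size⇒∈subsetsOfSize S |S|≡k)))

        |Ss|<rows+differences : length Ss ℕ.< suc ((t C suc k) ℕ.∸ t ℕ.+ 1) ℕ.+ suc (l ℕ.+ l)
        |Ss|<rows+differences = subst (ℕ._< suc ((t C suc k) ℕ.∸ t ℕ.+ 1) ℕ.+ suc (l ℕ.+ l))
          (sym (length-subsetsOfSize t (suc k))) (s≤s (ℕₚ.≤-trans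
          (ℕₚ.m≤n+m∸n (t C suc k) t)
          (ℕₚ.≤-reflexive (trans (ℕₚ.+-comm t _) (sym (ℕₚ.+-assoc ((t C suc k) ℕ.∸ t) 1 (suc (l ℕ.+ l))))))))

        dependency = orthogonal-to-independent⇒dependent Ss (λ i → Aentry t (suc k) (rows i)) difference
          independent-differences
          (λ i → differences-orthogonal (rows i) (rows-parts i) (m*[n/m]≡n k∣t))
          |Ss|<rows+differences
        e = proj₁ dependency
        e≢0 = proj₁ (proj₂ dependency)
        vanish = proj₂ (proj₂ dependency)

  even-decomposition : ∀ {t} → 6 ℕ.≤ t → 2 ∣ t → Σ ℕ λ l → 1 ℕ.< l × t ≡ suc (suc (l ℕ.+ l))
  even-decomposition 6≤t (divides q refl) with q
  ... | 0 = ⊥-elim (ℕₚ.<⇒≱ (s≤s z≤n) 6≤t)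
  ... | 1 = ⊥-elim (ℕₚ.<⇒≱ (s≤s (s≤s (s≤s z≤n))) 6≤t)
  ... | 2 = ⊥-elim (ℕₚ.<⇒≱ (s≤s (s≤s (s≤s (s≤s (s≤s z≤n))))) 6≤t)
  ... | suc (suc (suc l₀)) =
    l , s≤s (s≤s z≤n) , cong (λ n → suc (suc n)) (trans (ℕₚ.*-comm l 2) (cong (l ℕ.+_) (ℕₚ.+-identityʳ l)))
    where l = suc (suc l₀)

  AffineAndRankBounds : ℕ → ℕ → Set
  AffineAndRankBounds k t =
    ((p : ℚ) → 0ℚ < p → p < 1ℚ → Σ (Fin t → Member t) λ w → AffIndep t k t (λ i → memberVec t k p (w i)))
    × RankAtMost t k (λ _ → t div k) ((t C k) ℕ.∸ t ℕ.+ 1)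

open import Data.Nat using (ℕ; _≤_; _∸_; _+_)
open import Data.Nat using (suc; s≤s; z≤n)
open import Data.Nat.Divisibility using (_∣_)
open import Data.Nat.Combinatorics using (_C_)
open import Data.Fin using (Fin)
open import Data.Rational using (ℚ; 0ℚ; 1ℚ; _<_)
open import Data.Product using (Σ; _×_; _,_)
open import Data.Nat.Properties using (≤-trans; m≤m+n; m≤n+m)
open import Data.Rational.Properties using (<-irrefl)
open import Relation.Binary.PropositionalEquality using (refl; sym)

lemma5p1 : (k : ℕ) → 2 ≤ k →
    Σ ℕ λ T → (t : ℕ) → T ≤ t → 2 ∣ t → k ∣ t →
      ((p : ℚ) → 0ℚ < p → p < 1ℚ →
        Σ (Fin t → Member t) λ w → AffIndep t k t (λ i → memberVec t k p (w i)))
      × RankAtMost t k (λ _ → t div k) ((t C k) ∸ t + 1)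
lemma5p1 (suc (suc k)) (s≤s (s≤s z≤n)) = 6 + (K + K) , bounds
  where
    K = suc k
    bounds : ∀ t → 6 + (K + K) ≤ t → 2 ∣ t → suc K ∣ t → AffineAndRankBounds (suc K) t
    bounds t T≤t 2∣t K∣t with even-decomposition (≤-trans (m≤m+n 6 (K + K)) T≤t) 2∣t
    ... | l , 1<l , refl = affine , rank-bound K 2K+1≤t 1<l K∣t
      where
        open Construction l
        2K+1≤t = ≤-trans (m≤n+m (suc (K + K)) 5) T≤t
        affine = λ p 0<p _ →
          Vectors.members K p , Vectors.differences-independent K p (λ p≡0 → <-irrefl (sym p≡0) 0<p) 2K+1≤t 1<l
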